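{- Let $n=2k+1\ge5$ and let $\tilde{\mathbf{D}}_n$ be the simply-laced tree on vertices $0,1,\dots,n$ with edges $1-2$, $0-2$, $2-3,\dots,(n-3)-(n-2)$, $(n-2)-(n-1)$, $(n-2)-n$. Then every non-fixed labeling with $k$ components has label $1$ on at least one of the vertices $0,1,n-1,n$. Moreover, all non-fixed labelings with $k$ components whose restriction to the path $2,3,\dots,n-2$ has $k-1$ components are equivalent to one another.
   Context: Reeder's puzzle on a finite connected simple graph: a labeling assigns $a_j\in\mathbb{Z}/2\mathbb{Z}$ to each vertex $j$; the move $T_i$ replaces $a_i$ by $a_i+\sum_k a_k \pmod 2$ (sum over neighbors $k$ of $i$), other labels unchanged. Equivalence is generated by moves; a labeling is fixed if fixed by every move. Components of a labeling are the connected components of the subgraph induced on the vertices labeled $1$. -}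

module Defs where

open import Data.Nat using (ℕ; zero; suc; _+_; _*_; _∸_; _≡ᵇ_; _≤ᵇ_)
open import Data.Bool using (Bool; true; false; _∧_; _∨_; _xor_)
open import Data.Fin using (Fin; toℕ)
open import Data.Vec using (Vec; lookup; _[_]≔_)
open import Data.List using (foldr; map)
open import Data.List using () renaming (List to L)
open import Data.Fin.Base using ()
open import Data.List.Base using ()
open import Data.Product using (Σ; ∃; ∃-syntax; _×_)
open import Data.Sum using (_⊎_)
open import Relation.Binary.PropositionalEquality using (_≡_)
open import Relation.Binary.Construct.Closure.ReflexiveTransitive using (Star)
open import Relation.Nullary using (¬_)
open import Function.Bundles using (_⇔_)
open import Data.List using (List)
import Data.Fin as F

Graph : ℕ → Set
Graph m = Fin m → Fin m → Bool

-- A labeling: a value in Z/2Z (encoded as Bool, true = 1) for each vertex.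
Labeling : ℕ → Set
Labeling m = Vec Bool m

allFin : (m : ℕ) → List (Fin m)
allFin m = Data.List.tabulate (λ i → i)

neighbourSum : {m : ℕ} → Graph m → Labeling m → Fin m → Bool
neighbourSum {m} G a i = foldr _xor_ false (map (λ j → G i j ∧ lookup a j) (allFin m))

move : {m : ℕ} → Graph m → Fin m → Labeling m → Labeling m
move G i a = a [ i ]≔ (lookup a i xor neighbourSum G a i)

OneMove : {m : ℕ} → Graph m → Labeling m → Labeling m → Set
OneMove G a b = ∃[ i ] (move G i a ≡ b ⊎ move G i b ≡ a)

Equivalent : {m : ℕ} → Graph m → Labeling m → Labeling m → Set
Equivalent G = Star (OneMove G)

Fixed : {m : ℕ} → Graph m → Labeling m → Set
Fixed G a = ∀ i → move G i a ≡ a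

InducedEdge : {m : ℕ} → Graph m → (Fin m → Bool) → Labeling m → Fin m → Fin m → Set
InducedEdge G S a u v = (G u v ≡ true) × (S u ∧ lookup a u ≡ true) × (S v ∧ lookup a v ≡ true)

ConnectedIn : {m : ℕ} → Graph m → (Fin m → Bool) → Labeling m → Fin m → Fin m → Set
ConnectedIn G S a = Star (InducedEdge G S a)

-- The subgraph induced on {v | S v, a v = 1} has exactly c connected
-- components: there is a map from its vertices onto Fin c whose fibres are
-- exactly the connected components.
HasComponentsOn : {m : ℕ} → Graph m → (Fin m → Bool) → Labeling m → ℕ → Set
HasComponentsOn {m} G S a c =
  Σ (Fin m → Fin c) λ f →
    (∀ u v → (S u ∧ lookup a u ≡ true) → (S v ∧ lookup a v ≡ true) →
       (f u ≡ f v) ⇔ ConnectedIn G S a u v)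
    × (∀ (j : Fin c) → ∃[ v ] ((S v ∧ lookup a v ≡ true) × (f v ≡ j)))

HasComponents : {m : ℕ} → Graph m → Labeling m → ℕ → Set
HasComponents G a c = HasComponentsOn G (λ _ → true) a c

DtildeEdgeℕ : ℕ → ℕ → ℕ → Bool
DtildeEdgeℕ n x y =
     ((x ≡ᵇ 1) ∧ (y ≡ᵇ 2))
  ∨ ((x ≡ᵇ 0) ∧ (y ≡ᵇ 2))
  ∨ ((2 ≤ᵇ x) ∧ (x ≤ᵇ n ∸ 3) ∧ (y ≡ᵇ suc x))
  ∨ ((x ≡ᵇ n ∸ 2) ∧ (y ≡ᵇ n ∸ 1))
  ∨ ((x ≡ᵇ n ∸ 2) ∧ (y ≡ᵇ n))

Dtilde : (n : ℕ) → Graph (suc n)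
Dtilde n u v = DtildeEdgeℕ n (toℕ u) (toℕ v) ∨ DtildeEdgeℕ n (toℕ v) (toℕ u)

pathD : (n : ℕ) → Fin (suc n) → Bool
pathD n v = (2 ≤ᵇ toℕ v) ∧ (toℕ v ≤ᵇ n ∸ 2)

-- Number the path of D̃ₙ as 2 … n-2, so it has 2k - 2 vertices. Pairing consecutive path
-- vertices shows that a labeling has at most k - 1 components on the path, and at most k - 2 if
-- both ends of the path are unlabelled; without a labelled leaf every component lies on the path,
-- which gives the first assertion. Under the hypotheses of the second, exactly one end of the path
-- is labelled: if both are, every component meets the path. Re-pairing at any deviation from the
-- alternating pattern would save a component, so the path reads 1010…10 or 0101…01, and counting
-- components leaves exactly one labelled leaf at the unlabelled end. Such labelings are all
-- equivalent: the leaves at the labelled end can be flipped freely, and the alternating pattern can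
-- be pushed along the path one vertex at a time, each of these vertices having exactly one labelled
-- neighbour.

module Submission where

open import Defs
open import Data.Nat using (ℕ; suc; _+_; _*_; _∸_; _≤_)
open import Data.Bool using (true)
open import Data.Fin using (toℕ)
open import Data.Vec using (lookup)
open import Data.Product using (_×_; ∃-syntax)
open import Data.Sum using (_⊎_)
open import Relation.Binary.PropositionalEquality using (_≡_)
open import Relation.Nullary using (¬_)

open import Data.Nat
  using (zero; pred; _<_; _⊔_; _⊓_; z≤n; s≤s; z<s; s<s; s<s⁻¹; s≤s⁻¹; ⌊_/2⌋; _<ᵇ_; _≤ᵇ_; _≡ᵇ_; _<?_; _≟_)
open import Data.Nat.Properties
open import Data.Bool using (Bool; false; not; _∧_; _∨_; _xor_; T; if_then_else_)
import Data.Bool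
open import Data.Bool.Properties
  using (T-≡; T-∨; T-∧; ∨-comm; ¬-not; not-involutive; not-distribˡ-xor; xor-identityʳ)
open import Data.Fin using (Fin; fromℕ<)
import Data.Fin.Properties as Fin
open import Data.Vec using (Vec; tabulate; []; _∷_)
open import Data.Vec.Properties
  using (lookup∘tabulate; tabulate∘lookup; tabulate-cong; lookup∘update; lookup∘update′)
open import Data.Vec.Functional using () renaming (_∷_ to _∷ᶠ_)
import Data.List as List
import Data.List.Properties as List
open import Data.Product using (Σ; _,_; proj₁; proj₂)
open import Data.Sum using (inj₁; inj₂) renaming (map to ⊎-map)
open import Data.Unit using (tt)
open import Data.Empty using (⊥; ⊥-elim)
open import Function using (id; _∘′_; case_of_)
open import Function.Definitions using (Injective)
open import Function.Bundles using (Equivalence)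
open import Relation.Nullary using (yes; no)
open import Relation.Binary.Definitions using (tri<; tri≈; tri>)
open import Relation.Binary.PropositionalEquality
open import Relation.Binary.Construct.Closure.ReflexiveTransitive using (ε; _◅_; _◅◅_; reverse; gmap)

even : ℕ → Bool
even zero = true
even (suc zero) = false
even (suc (suc n)) = even n

even-suc : ∀ n → even (suc n) ≡ not (even n)
even-suc zero = refl
even-suc (suc zero) = refl
even-suc (suc (suc n)) = even-suc n

even-double : ∀ n → even (n + n) ≡ true
even-double zero = refl
even-double (suc n) rewrite +-suc n n = even-double n

suc+suc : ∀ r → suc r + suc r ≡ suc (suc (r + r))
suc+suc r = cong suc (+-suc r r)

⌊/2⌋-< : ∀ {o} r → o < r + r → ⌊ o /2⌋ < r
⌊/2⌋-< {o} zero ()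
⌊/2⌋-< {zero} (suc r) _ = z<s
⌊/2⌋-< {suc zero} (suc r) _ = z<s
⌊/2⌋-< {suc (suc o)} (suc r) o<2r rewrite suc+suc r = s<s (⌊/2⌋-< r (s<s⁻¹ (s<s⁻¹ o<2r)))

⌊/2⌋-≡ : ∀ {o o′} → o < o′ → ⌊ o /2⌋ ≡ ⌊ o′ /2⌋ → o′ ≡ suc o
⌊/2⌋-≡ {zero} {suc zero} _ _ = refl
⌊/2⌋-≡ {zero} {suc (suc o′)} _ ()
⌊/2⌋-≡ {suc zero} {suc zero} (s<s ()) _
⌊/2⌋-≡ {suc zero} {suc (suc o′)} _ ()
⌊/2⌋-≡ {suc (suc o)} {suc (suc o′)} o<o′ eq =
  cong (suc ∘′ suc) (⌊/2⌋-≡ (s<s⁻¹ (s<s⁻¹ o<o′)) (suc-injective eq))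

-- shiftedHalf j o = ⌊ o /2⌋ for o ≤ j and ⌊ (o ∸ 1) /2⌋ for j < o: the pairing
-- {0,1},{2,3},… of offsets switches to {1,2},{3,4},… after j, so one class
-- {o, o+1, o+2} with o even contains j or j-1.
shiftedHalf : ℕ → ℕ → ℕ
shiftedHalf (suc (suc j)) (suc (suc o)) = suc (shiftedHalf j o)
shiftedHalf (suc (suc j)) _ = 0
shiftedHalf _ o = ⌊ pred o /2⌋

shiftedHalf-≡ : ∀ j {o o′} → o < o′ → shiftedHalf j o ≡ shiftedHalf j o′ →
  o′ ≡ suc o ⊎ (o′ ≡ suc (suc o) × even o ≡ true × (j ≡ o ⊎ j ≡ suc o))
shiftedHalf-≡ (suc (suc j)) {zero} {suc zero} _ _ = inj₁ refl
shiftedHalf-≡ (suc (suc j)) {zero} {suc (suc o′)} _ ()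
shiftedHalf-≡ (suc (suc j)) {suc zero} {suc zero} (s<s ()) _
shiftedHalf-≡ (suc (suc j)) {suc zero} {suc (suc o′)} _ ()
shiftedHalf-≡ (suc (suc j)) {suc (suc o)} {suc (suc o′)} o<o′ eq
  with shiftedHalf-≡ j (s<s⁻¹ (s<s⁻¹ o<o′)) (suc-injective eq)
... | inj₁ o′≡ = inj₁ (cong (suc ∘′ suc) o′≡)
... | inj₂ (o′≡ , even-o , j≡) =
  inj₂ (cong (suc ∘′ suc) o′≡ , even-o , ⊎-map (cong (suc ∘′ suc)) (cong (suc ∘′ suc)) j≡)
shiftedHalf-≡ zero {zero} {suc zero} _ _ = inj₁ refl
shiftedHalf-≡ zero {zero} {suc (suc zero)} _ _ = inj₂ (refl , refl , inj₁ refl)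
shiftedHalf-≡ zero {zero} {suc (suc (suc o′))} _ ()
shiftedHalf-≡ zero {suc o} {suc o′} o<o′ eq = inj₁ (cong suc (⌊/2⌋-≡ (s<s⁻¹ o<o′) eq))
shiftedHalf-≡ (suc zero) {zero} {suc zero} _ _ = inj₁ refl
shiftedHalf-≡ (suc zero) {zero} {suc (suc zero)} _ _ = inj₂ (refl , refl , inj₂ refl)
shiftedHalf-≡ (suc zero) {zero} {suc (suc (suc o′))} _ ()
shiftedHalf-≡ (suc zero) {suc o} {suc o′} o<o′ eq = inj₁ (cong suc (⌊/2⌋-≡ (s<s⁻¹ o<o′) eq))

shiftedHalf-< : ∀ j {o} r → o ≤ r + r → j < o ⊎ o < r + r → shiftedHalf j o < r
shiftedHalf-< (suc (suc j)) {suc (suc o)} (suc r) o≤2r j<o⊎o<2r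
  rewrite suc+suc r =
  s<s (shiftedHalf-< j r (s≤s⁻¹ (s≤s⁻¹ o≤2r)) (⊎-map (s<s⁻¹ ∘′ s<s⁻¹) (s<s⁻¹ ∘′ s<s⁻¹) j<o⊎o<2r))
shiftedHalf-< (suc (suc j)) {suc (suc o)} zero () _
shiftedHalf-< (suc (suc j)) {zero} (suc r) _ _ = z<s
shiftedHalf-< (suc (suc j)) {suc zero} (suc r) _ _ = z<s
shiftedHalf-< (suc (suc j)) {zero} zero _ (inj₂ ())
shiftedHalf-< (suc (suc j)) {suc zero} zero _ (inj₂ ())
shiftedHalf-< (suc (suc j)) {zero} r _ (inj₁ ())
shiftedHalf-< (suc (suc j)) {suc zero} r _ (inj₁ (s<s ()))
shiftedHalf-< zero {zero} r _ (inj₂ 0<2r) = ⌊/2⌋-< r 0<2r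
shiftedHalf-< zero {zero} r _ (inj₁ ())
shiftedHalf-< zero {suc o} r o<2r _ = ⌊/2⌋-< r o<2r
shiftedHalf-< (suc zero) {zero} r _ (inj₂ 0<2r) = ⌊/2⌋-< r 0<2r
shiftedHalf-< (suc zero) {zero} r _ (inj₁ ())
shiftedHalf-< (suc zero) {suc o} r o<2r _ = ⌊/2⌋-< r o<2r

∸-suc-cancel : ∀ {s x y} → s ≤ x → s ≤ y → y ∸ s ≡ suc (x ∸ s) → y ≡ suc x
∸-suc-cancel s≤x s≤y eq = ∸-cancelʳ-≡ s≤y (m≤n⇒m≤1+n s≤x) (trans eq (sym (+-∸-assoc 1 s≤x)))

offset-< : ∀ {s x l} → s ≤ x → x < s + l → x ∸ s < l
offset-< {s} {x} {l} s≤x x<s+l = subst (x ∸ s <_) (m+n∸m≡n s l) (∸-monoˡ-< x<s+l s≤x)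

double-injective : ∀ {i j} → i + i ≡ j + j → i ≡ j
double-injective {i} {j} eq = trans (n≡⌊n+n/2⌋ i) (trans (cong ⌊_/2⌋ eq) (sym (n≡⌊n+n/2⌋ j)))

cons-injective : ∀ {n} {p : ℕ} {f : Fin n → ℕ} → Injective _≡_ _≡_ f → (∀ i → f i ≢ p) →
                 Injective _≡_ _≡_ (p ∷ᶠ f)
cons-injective f-inj p∉f {Fin.zero} {Fin.zero} _ = refl
cons-injective f-inj p∉f {Fin.zero} {Fin.suc j} eq = ⊥-elim (p∉f j (sym eq))
cons-injective f-inj p∉f {Fin.suc i} {Fin.zero} eq = ⊥-elim (p∉f i eq)
cons-injective f-inj p∉f {Fin.suc i} {Fin.suc j} eq = cong Fin.suc (f-inj eq)

not-true : ∀ {b} → not b ≡ true → b ≡ false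
not-true {false} _ = refl

<ᵇ-true : ∀ {m n} → m < n → (m <ᵇ n) ≡ true
<ᵇ-true m<n = Equivalence.to T-≡ (<⇒<ᵇ m<n)

<ᵇ-false : ∀ {m n} → n ≤ m → (m <ᵇ n) ≡ false
<ᵇ-false {m} {n} n≤m = ¬-not λ m<ᵇn → <⇒≱ (<ᵇ⇒< m n (Equivalence.from T-≡ m<ᵇn)) n≤m

≤ᵇ-true : ∀ {m n} → m ≤ n → (m ≤ᵇ n) ≡ true
≤ᵇ-true m≤n = Equivalence.to T-≡ (≤⇒≤ᵇ m≤n)

≡ᵇ-refl : ∀ n → (n ≡ᵇ n) ≡ true
≡ᵇ-refl n = Equivalence.to T-≡ (≡⇒≡ᵇ n n refl)

≡ᵇ-false : ∀ {m n} → m ≢ n → (m ≡ᵇ n) ≡ false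
≡ᵇ-false {m} {n} m≢n = ¬-not λ m≡ᵇn → m≢n (≡ᵇ⇒≡ m n (Equivalence.from T-≡ m≡ᵇn))

∧-true : ∀ {b c} → b ∧ c ≡ true → b ≡ true × c ≡ true
∧-true {true} {true} _ = refl , refl

<ᵇ-suc : ∀ {z d} → z ≢ d → (z <ᵇ suc d) ≡ (z <ᵇ d)
<ᵇ-suc {zero} {zero} z≢d = ⊥-elim (z≢d refl)
<ᵇ-suc {zero} {suc d} _ = refl
<ᵇ-suc {suc z} {zero} _ = refl
<ᵇ-suc {suc z} {suc d} z≢d = <ᵇ-suc {z} {d} (z≢d ∘′ cong suc)

suc-<ᵇ : ∀ {z d} → suc z ≢ d → (suc z <ᵇ d) ≡ (z <ᵇ d)
suc-<ᵇ {z} {zero} _ = refl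
suc-<ᵇ {zero} {suc zero} 1≢d = ⊥-elim (1≢d refl)
suc-<ᵇ {zero} {suc (suc d)} _ = refl
suc-<ᵇ {suc z} {suc d} z≢d = suc-<ᵇ {z} {d} (z≢d ∘′ cong suc)

xor≡true⇒≡not : ∀ {x y} → x xor y ≡ true → x ≡ not y
xor≡true⇒≡not {true} {false} _ = refl
xor≡true⇒≡not {false} {true} _ = refl

xor-true : ∀ b → b xor true ≡ not b
xor-true false = refl
xor-true true = refl

lookup-ext : ∀ {N} {A : Set} {xs ys : Vec A N} → (∀ i → lookup xs i ≡ lookup ys i) → xs ≡ ys
lookup-ext {xs = xs} {ys} eq =
  trans (sym (tabulate∘lookup xs)) (trans (tabulate-cong eq) (tabulate∘lookup ys))

-- a_x for a vertex numbered x, read as false beyond the last vertex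
label : ∀ {N} → Labeling N → ℕ → Bool
label [] _ = false
label (b ∷ a) zero = b
label (b ∷ a) (suc x) = label a x

lookup≡label : ∀ {N} (a : Labeling N) (v : Fin N) → lookup a v ≡ label a (toℕ v)
lookup≡label (b ∷ a) Fin.zero = refl
lookup≡label (b ∷ a) (Fin.suc v) = lookup≡label a v

label-ext : ∀ {N} (a : Labeling N) (f : ℕ → Bool) → (∀ x → x < N → label a x ≡ f x) → a ≡ tabulate (f ∘′ toℕ)
label-ext a f a≗f = lookup-ext λ v →
  trans (lookup≡label a v) (trans (a≗f (toℕ v) (Fin.toℕ<n v)) (sym (lookup∘tabulate (f ∘′ toℕ) v)))

label-tabulate : ∀ {N} (f : ℕ → Bool) {x} → x < N → label (tabulate {n = N} (f ∘′ toℕ)) x ≡ f x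
label-tabulate {N} f {x} x<N = begin
  label a x                  ≡⟨ cong (label a) (sym (Fin.toℕ-fromℕ< x<N)) ⟩
  label a (toℕ v)            ≡⟨ sym (lookup≡label a v) ⟩
  lookup a v                 ≡⟨ lookup∘tabulate (f ∘′ toℕ) v ⟩
  f (toℕ v)                  ≡⟨ cong f (Fin.toℕ-fromℕ< x<N) ⟩
  f x                        ∎
  where
    open ≡-Reasoning
    a : Labeling N
    a = tabulate (f ∘′ toℕ)
    v : Fin N
    v = fromℕ< x<N

-- Connected components of a labeling

Labelled : {N : ℕ} → (Fin N → Bool) → Labeling N → Fin N → Set
Labelled S a v = S v ∧ lookup a v ≡ true

Symmetric : {N : ℕ} → Graph N → Set
Symmetric G = ∀ u v → G u v ≡ G v u

module _ {N : ℕ} (G : Graph N) (S : Fin N → Bool) (a : Labeling N) where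

  private
    Lab = Labelled S a
    _~_ = ConnectedIn G S a

  connected-edge : ∀ {u v} → G u v ≡ true → Lab u → Lab v → u ~ v
  connected-edge uv lu lv = (uv , lu , lv) ◅ ε

  connected-sym : Symmetric G → ∀ {u v} → u ~ v → v ~ u
  connected-sym G-sym = reverse λ {u} {v} (uv , lu , lv) → trans (G-sym v u) uv , lv , lu

  connected-invariant : (c : Fin N → ℕ) → (∀ {u v} → InducedEdge G S a u v → c u ≡ c v) →
                        ∀ {u v} → u ~ v → c u ≡ c v
  connected-invariant c inv ε = refl
  connected-invariant c inv (e ◅ es) = trans (inv e) (connected-invariant c inv es)

  components-≤ : ∀ {c d} → HasComponentsOn G S a c → (g : Fin N → ℕ) →
                 (∀ v → Lab v → g v < d) →
                 (∀ u v → Lab u → Lab v → g u ≡ g v → u ~ v) → c ≤ d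
  components-≤ {c} {d} (f , classes , onto) g g<d same-colour = Fin.injective⇒≤ colour-injective
    where
      rep : Fin c → Fin N
      rep j = proj₁ (onto j)
      rep-labelled : ∀ j → Lab (rep j)
      rep-labelled j = proj₁ (proj₂ (onto j))
      colour : Fin c → Fin d
      colour j = fromℕ< (g<d (rep j) (rep-labelled j))
      colour-injective : ∀ {i j} → colour i ≡ colour j → i ≡ j
      colour-injective {i} {j} eq = begin
        i             ≡⟨ sym (proj₂ (proj₂ (onto i))) ⟩
        f (rep i)     ≡⟨ Equivalence.from (classes _ _ (rep-labelled i) (rep-labelled j))
                                          (same-colour _ _ (rep-labelled i) (rep-labelled j) g≡) ⟩
        f (rep j)     ≡⟨ proj₂ (proj₂ (onto j)) ⟩
        j             ∎
        where
          open ≡-Reasoning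
          g≡ : g (rep i) ≡ g (rep j)
          g≡ = trans (sym (Fin.toℕ-fromℕ< _)) (trans (cong toℕ eq) (Fin.toℕ-fromℕ< _))

  ≤-components : ∀ {c d} → HasComponentsOn G S a c → (e : Fin d → Fin N) →
                 (∀ j → Lab (e j)) → (∀ i j → e i ~ e j → i ≡ j) → d ≤ c
  ≤-components (f , classes , _) e e-labelled separated =
    Fin.injective⇒≤ λ {i} {j} eq →
      separated i j (Equivalence.to (classes _ _ (e-labelled i) (e-labelled j)) eq)

  same-colour-connected : Symmetric G → (g : Fin N → ℕ) →
    (∀ u v → toℕ u < toℕ v → Lab u → Lab v → g u ≡ g v → u ~ v) →
    ∀ u v → Lab u → Lab v → g u ≡ g v → u ~ v
  same-colour-connected G-sym g ordered u v lu lv eq with <-cmp (toℕ u) (toℕ v)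
  ... | tri< u<v _ _ = ordered u v u<v lu lv eq
  ... | tri≈ _ u≡v _ = subst (u ~_) (Fin.toℕ-injective u≡v) ε
  ... | tri> _ _ v<u = connected-sym G-sym (ordered v u v<u lv lu (sym eq))

components-≤-projection : ∀ {N} (G : Graph N) (S T : Fin N → Bool) (a : Labeling N) {c c′} →
  Symmetric G → HasComponentsOn G S a c → HasComponentsOn G T a c′ →
  (∀ v → Labelled T a v → Labelled S a v) → (π : Fin N → Fin N) →
  (∀ v → Labelled S a v → Labelled T a (π v) × ConnectedIn G S a v (π v)) → c ≤ c′
components-≤-projection G S T a G-sym hS (f , classes , _) T⊆S π proj =
  components-≤ G S a hS (λ v → toℕ (f (π v))) (λ v _ → Fin.toℕ<n _) same-class
  where
    same-class : ∀ u v → Labelled S a u → Labelled S a v → toℕ (f (π u)) ≡ toℕ (f (π v)) →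
                 ConnectedIn G S a u v
    same-class u v lu lv eq =
      proj₂ (proj u lu)
      ◅◅ gmap (λ x → x) (λ (e , lx , ly) → e , T⊆S _ lx , T⊆S _ ly)
           (Equivalence.to (classes _ _ (proj₁ (proj u lu)) (proj₁ (proj v lv))) (Fin.toℕ-injective eq))
      ◅◅ connected-sym G S a G-sym (proj₂ (proj v lv))

-- Labelled vertices filling a segment of consecutive positions

ConsecutiveAdjacent : ∀ {N} → Graph N → (Fin N → Bool) → Labeling N → Set
ConsecutiveAdjacent G S a =
  ∀ u v → Labelled S a u → Labelled S a v → toℕ v ≡ suc (toℕ u) → G u v ≡ true

LabelledWithin : ∀ {N} → (Fin N → Bool) → Labeling N → (s l : ℕ) → Set
LabelledWithin S a s l = ∀ v → Labelled S a v → s ≤ toℕ v × toℕ v < s + l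

module _ {N : ℕ} {G : Graph N} (G-sym : Symmetric G) (S : Fin N → Bool) (a : Labeling N)
         (adjacent : ConsecutiveAdjacent G S a) where

  private
    Lab = Labelled S a

  segment-components-≤ : ∀ {c} s r → HasComponentsOn G S a c → LabelledWithin S a s (r + r) → c ≤ r
  segment-components-≤ s r hc within =
    components-≤ G S a hc colour (λ v lv → ⌊/2⌋-< r (offset-< (proj₁ (within v lv)) (proj₂ (within v lv))))
      (same-colour-connected G S a G-sym colour same-colour-ordered)
    where
      colour : Fin N → ℕ
      colour v = ⌊ (toℕ v ∸ s) /2⌋
      same-colour-ordered : ∀ u v → toℕ u < toℕ v → Lab u → Lab v → colour u ≡ colour v →
                            ConnectedIn G S a u v
      same-colour-ordered u v u<v lu lv eq = connected-edge G S a (adjacent u v lu lv v≡1+u) lu lv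
        where
          s≤u = proj₁ (within u lu)
          s≤v = proj₁ (within v lv)
          v≡1+u : toℕ v ≡ suc (toℕ u)
          v≡1+u = ∸-suc-cancel s≤u s≤v (⌊/2⌋-≡ (∸-monoˡ-< u<v s≤u) eq)

  -- Given a vertex w of the segment whose label deviates from the pattern 1010…, the pairing of
  -- offsets may switch parity at j = w − s; this colours the labelled vertices with r colours.
  module Deviation (s r : ℕ) (within : LabelledWithin S a s (suc (r + r))) (w : Fin N)
                   (s≤w : s ≤ toℕ w) (w<end : toℕ w < s + suc (r + r))
                   (w-label : S w ∧ lookup a w ≡ not (even (toℕ w ∸ s))) where

    private
      j = toℕ w ∸ s
      offset : Fin N → ℕ
      offset v = toℕ v ∸ s

    colour : Fin N → ℕ
    colour v = shiftedHalf j (offset v)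

    labelled-at-j : ∀ v → Lab v → offset v ≡ j → even j ≡ false
    labelled-at-j v lv o≡j = not-true (trans (sym w-label) (subst Lab v≡w lv))
      where
        v≡w : v ≡ w
        v≡w = Fin.toℕ-injective (∸-cancelʳ-≡ (proj₁ (within v lv)) s≤w o≡j)

    colour<r : ∀ v → Lab v → colour v < r
    colour<r v lv = shiftedHalf-< j r o≤2r j<o⊎o<2r
      where
        o≤2r : offset v ≤ r + r
        o≤2r = s≤s⁻¹ (offset-< (proj₁ (within v lv)) (proj₂ (within v lv)))
        j<o⊎o<2r : j < offset v ⊎ offset v < r + r
        j<o⊎o<2r with offset v ≟ r + r
        ... | no o≢2r = inj₂ (≤∧≢⇒< o≤2r o≢2r)
        ... | yes o≡2r = inj₁ (≤∧≢⇒< (subst (j ≤_) (sym o≡2r) (s≤s⁻¹ (offset-< s≤w w<end))) j≢o)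
          where
            j≢o : j ≢ offset v
            j≢o j≡o = case trans (sym (labelled-at-j v lv (sym j≡o)))
                                 (trans (cong even (trans j≡o o≡2r)) (even-double r)) of λ ()

    same-colour-ordered : ∀ u v → toℕ u < toℕ v → Lab u → Lab v → colour u ≡ colour v →
                          ConnectedIn G S a u v
    same-colour-ordered u v u<v lu lv eq with shiftedHalf-≡ j (∸-monoˡ-< u<v (proj₁ (within u lu))) eq
    ... | inj₁ v≡1+u =
      connected-edge G S a (adjacent u v lu lv (∸-suc-cancel s≤u (proj₁ (within v lv)) v≡1+u)) lu lv
      where s≤u = proj₁ (within u lu)
    ... | inj₂ (_ , even-o , inj₁ j≡o) =
      case trans (sym (labelled-at-j u lu (sym j≡o))) (trans (cong even j≡o) even-o) of λ ()
    ... | inj₂ (v≡2+u , even-o , inj₂ j≡1+o) =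
      connected-edge G S a (adjacent u w lu lw w≡1+u) lu lw
      ◅◅ connected-edge G S a (adjacent w v lw lv v≡1+w) lw lv
      where
        lw : Lab w
        lw = trans w-label (trans (cong (not ∘′ even) j≡1+o)
               (trans (cong not (even-suc (offset u))) (trans (not-involutive _) even-o)))
        w≡1+u : toℕ w ≡ suc (toℕ u)
        w≡1+u = ∸-suc-cancel (proj₁ (within u lu)) s≤w j≡1+o
        v≡1+w : toℕ v ≡ suc (toℕ w)
        v≡1+w = ∸-suc-cancel s≤w (proj₁ (within v lv)) (trans v≡2+u (cong suc (sym j≡1+o)))

  segment-alternates : ∀ s r → HasComponentsOn G S a (suc r) → LabelledWithin S a s (suc (r + r)) →
    ∀ w → s ≤ toℕ w → toℕ w < s + suc (r + r) → S w ∧ lookup a w ≡ even (toℕ w ∸ s)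
  segment-alternates s r hc within w s≤w w<end with S w ∧ lookup a w Data.Bool.≟ even (toℕ w ∸ s)
  ... | yes alternates = alternates
  ... | no deviates =
    ⊥-elim (1+n≰n (components-≤ G S a hc colour colour<r
                     (same-colour-connected G S a G-sym colour same-colour-ordered)))
    where open Deviation s r within w s≤w w<end (¬-not deviates)

xor-sum-false : ∀ {N} (h : Fin N → Bool) → (∀ j → h j ≡ false) →
                List.foldr _xor_ false (List.tabulate h) ≡ false
xor-sum-false {zero} h _ = refl
xor-sum-false {suc N} h h≡false rewrite h≡false Fin.zero =
  xor-sum-false (h ∘′ Fin.suc) (λ j → h≡false (Fin.suc j))

xor-sum-single : ∀ {N} (h : Fin N → Bool) (w : Fin N) → h w ≡ true → (∀ j → h j ≡ true → j ≡ w) →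
                 List.foldr _xor_ false (List.tabulate h) ≡ true
xor-sum-single h Fin.zero hw only-w
  rewrite hw | xor-sum-false (h ∘′ Fin.suc) (λ j → ¬-not λ hj → case only-w (Fin.suc j) hj of λ ()) = refl
xor-sum-single h (Fin.suc w) hw only-w
  rewrite ¬-not {h Fin.zero} (λ h0 → case only-w Fin.zero h0 of λ ()) =
  xor-sum-single (h ∘′ Fin.suc) w hw (λ j hj → Fin.suc-injective (only-w (Fin.suc j) hj))

unique-neighbour-flip : ∀ {N} (G : Graph N) (f g : Fin N → Bool) (i w : Fin N) →
  G i w ∧ f w ≡ true → (∀ j → G i j ∧ f j ≡ true → j ≡ w) →
  g i ≡ not (f i) → (∀ j → j ≢ i → g j ≡ f j) → OneMove G (tabulate f) (tabulate g)
unique-neighbour-flip {N} G f g i w iw only-w gi g-elsewhere = i , inj₁ (lookup-ext pointwise)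
  where
    a = tabulate f
    h : Fin N → Bool
    h j = G i j ∧ lookup a j
    sum≡true : neighbourSum G a i ≡ true
    sum≡true = trans (cong (List.foldr _xor_ false) (List.map-tabulate (λ j → j) h))
                     (xor-sum-single h w (subst (λ b → G i w ∧ b ≡ true) (sym (lookup∘tabulate f w)) iw)
                       (λ j hj → only-w j (subst (λ b → G i j ∧ b ≡ true) (lookup∘tabulate f j) hj)))
    pointwise : ∀ j → lookup (move G i a) j ≡ lookup (tabulate g) j
    pointwise j with j Fin.≟ i
    ... | yes refl = begin
      lookup (move G i a) i                ≡⟨ lookup∘update i a _ ⟩
      lookup a i xor neighbourSum G a i    ≡⟨ cong₂ _xor_ (lookup∘tabulate f i) sum≡true ⟩
      f i xor true                         ≡⟨ xor-true (f i) ⟩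
      not (f i)                            ≡⟨ sym gi ⟩
      g i                                  ≡⟨ sym (lookup∘tabulate g i) ⟩
      lookup (tabulate g) i                ∎
      where open ≡-Reasoning
    ... | no j≢i = begin
      lookup (move G i a) j      ≡⟨ lookup∘update′ j≢i a _ ⟩
      lookup a j                 ≡⟨ lookup∘tabulate f j ⟩
      f j                        ≡⟨ sym (g-elsewhere j j≢i) ⟩
      g j                        ≡⟨ sym (lookup∘tabulate g j) ⟩
      lookup (tabulate g) j      ∎
      where open ≡-Reasoning

-- D̃ₙ for n = 2k + 1 and k = m + 2: the path 2 … ℓ+1 of ℓ = 2k - 2 vertices, with leaves 0, 1
-- attached to 2 and ℓ+2, ℓ+3 attached to ℓ+1.
module AffineD (m : ℕ) where

  ℓ : ℕ
  ℓ = suc (suc (m + m))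

  n : ℕ
  n = 3 + ℓ

  N : ℕ
  N = suc n

  D : Graph N
  D = Dtilde n

  D-sym : Symmetric D
  D-sym u v = ∨-comm (DtildeEdgeℕ n (toℕ u) (toℕ v)) _

  data Edge : ℕ → ℕ → Set where
    left-leaf   : ∀ {x} → x ≤ 1 → Edge x 2
    along-path  : ∀ {x} → 2 ≤ x → x ≤ ℓ → Edge x (suc x)
    right-leaf₀ : Edge (suc ℓ) (2 + ℓ)
    right-leaf₁ : Edge (suc ℓ) (3 + ℓ)

  Adjacent : ℕ → ℕ → Set
  Adjacent x y = Edge x y ⊎ Edge y x

  private
    ∨-split : ∀ {b c} → T (b ∨ c) → T b ⊎ T c
    ∨-split = Equivalence.to T-∨
    ∧-split : ∀ {b c} → T (b ∧ c) → T b × T c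
    ∧-split = Equivalence.to T-∧
    ∨-inl : ∀ {b c} → T b → T (b ∨ c)
    ∨-inl p = Equivalence.from T-∨ (inj₁ p)
    ∨-inr : ∀ {b c} → T c → T (b ∨ c)
    ∨-inr p = Equivalence.from T-∨ (inj₂ p)
    ∧-intro : ∀ {b c} → T b → T c → T (b ∧ c)
    ∧-intro p q = Equivalence.from T-∧ (p , q)

  edge-sound : ∀ x y → T (DtildeEdgeℕ n x y) → Edge x y
  edge-sound x y t with ∨-split t
  ... | inj₁ t₁ = let (x≡1 , y≡2) = ∧-split t₁ in
    subst₂ Edge (sym (≡ᵇ⇒≡ x 1 x≡1)) (sym (≡ᵇ⇒≡ y 2 y≡2)) (left-leaf ≤-refl)
  ... | inj₂ t₂ with ∨-split t₂
  ... | inj₁ t₃ = let (x≡0 , y≡2) = ∧-split t₃ in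
    subst₂ Edge (sym (≡ᵇ⇒≡ x 0 x≡0)) (sym (≡ᵇ⇒≡ y 2 y≡2)) (left-leaf z≤n)
  ... | inj₂ t₄ with ∨-split t₄
  ... | inj₁ t₅ = let (2≤x , t₆) = ∧-split t₅ ; (x≤ℓ , y≡1+x) = ∧-split {x ≤ᵇ ℓ} t₆ in
    subst (Edge x) (sym (≡ᵇ⇒≡ y (suc x) y≡1+x)) (along-path (≤ᵇ⇒≤ 2 x 2≤x) (≤ᵇ⇒≤ x ℓ x≤ℓ))
  ... | inj₂ t₇ with ∨-split t₇
  ... | inj₁ t₈ = let (x≡1+ℓ , y≡2+ℓ) = ∧-split t₈ in
    subst₂ Edge (sym (≡ᵇ⇒≡ x (suc ℓ) x≡1+ℓ)) (sym (≡ᵇ⇒≡ y (2 + ℓ) y≡2+ℓ)) right-leaf₀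
  ... | inj₂ t₉ = let (x≡1+ℓ , y≡3+ℓ) = ∧-split t₉ in
    subst₂ Edge (sym (≡ᵇ⇒≡ x (suc ℓ) x≡1+ℓ)) (sym (≡ᵇ⇒≡ y (3 + ℓ) y≡3+ℓ)) right-leaf₁

  edge-complete : ∀ {x y} → Edge x y → T (DtildeEdgeℕ n x y)
  edge-complete (left-leaf {zero} _) = tt
  edge-complete (left-leaf {suc zero} _) = tt
  edge-complete (left-leaf {suc (suc _)} (s≤s ()))
  edge-complete (along-path {x} 2≤x x≤ℓ) =
    ∨-inr {(x ≡ᵇ 1) ∧ (suc x ≡ᵇ 2)} (∨-inr {(x ≡ᵇ 0) ∧ (suc x ≡ᵇ 2)}
      (∨-inl (∧-intro (≤⇒≤ᵇ 2≤x) (∧-intro (≤⇒≤ᵇ x≤ℓ) (≡⇒≡ᵇ (suc x) (suc x) refl)))))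
  edge-complete right-leaf₀ =
    ∨-inr {(suc ℓ ≡ᵇ 1) ∧ (2 + ℓ ≡ᵇ 2)} (∨-inr {(suc ℓ ≡ᵇ 0) ∧ (2 + ℓ ≡ᵇ 2)}
      (∨-inr {(2 ≤ᵇ suc ℓ) ∧ ((suc ℓ ≤ᵇ ℓ) ∧ (2 + ℓ ≡ᵇ 2 + ℓ))}
        (∨-inl (∧-intro (≡⇒≡ᵇ (suc ℓ) _ refl) (≡⇒≡ᵇ (2 + ℓ) _ refl)))))
  edge-complete right-leaf₁ =
    ∨-inr {(suc ℓ ≡ᵇ 1) ∧ (3 + ℓ ≡ᵇ 2)} (∨-inr {(suc ℓ ≡ᵇ 0) ∧ (3 + ℓ ≡ᵇ 2)}
      (∨-inr {(2 ≤ᵇ suc ℓ) ∧ ((suc ℓ ≤ᵇ ℓ) ∧ (3 + ℓ ≡ᵇ 2 + ℓ))}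
        (∨-inr {(suc ℓ ≡ᵇ suc ℓ) ∧ (3 + ℓ ≡ᵇ 2 + ℓ)} (∧-intro (≡⇒≡ᵇ (suc ℓ) _ refl) (≡⇒≡ᵇ (3 + ℓ) _ refl)))))

  D-sound : ∀ u v → D u v ≡ true → Adjacent (toℕ u) (toℕ v)
  D-sound u v uv with ∨-split (Equivalence.from T-≡ uv)
  ... | inj₁ t = inj₁ (edge-sound _ _ t)
  ... | inj₂ t = inj₂ (edge-sound _ _ t)

  D-complete : ∀ u v → Adjacent (toℕ u) (toℕ v) → D u v ≡ true
  D-complete u v (inj₁ e) = Equivalence.to T-≡ (∨-inl (edge-complete e))
  D-complete u v (inj₂ e) = Equivalence.to T-≡ (∨-inr {DtildeEdgeℕ n (toℕ u) (toℕ v)} (edge-complete e))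

  left-leaf-neighbour : ∀ {x y} → x ≤ 1 → Adjacent x y → y ≡ 2
  left-leaf-neighbour _ (inj₁ (left-leaf _)) = refl
  left-leaf-neighbour x≤1 (inj₁ (along-path 2≤x _)) = ⊥-elim (≤⇒≯ x≤1 2≤x)
  left-leaf-neighbour (s≤s ()) (inj₁ right-leaf₀)
  left-leaf-neighbour (s≤s ()) (inj₁ right-leaf₁)
  left-leaf-neighbour (s≤s ()) (inj₂ (left-leaf _))
  left-leaf-neighbour (s≤s ()) (inj₂ (along-path (s≤s (s≤s _)) _))
  left-leaf-neighbour (s≤s ()) (inj₂ right-leaf₀)
  left-leaf-neighbour (s≤s ()) (inj₂ right-leaf₁)

  right-leaf-neighbour : ∀ {x y} → suc ℓ < x → Adjacent x y → y ≡ suc ℓ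
  right-leaf-neighbour ℓ+1<x (inj₁ (left-leaf x≤1)) = ⊥-elim (<⇒≱ ℓ+1<x (≤-trans x≤1 (s≤s z≤n)))
  right-leaf-neighbour ℓ+1<x (inj₁ (along-path _ x≤ℓ)) = ⊥-elim (<⇒≱ ℓ+1<x (m≤n⇒m≤1+n x≤ℓ))
  right-leaf-neighbour ℓ+1<x (inj₁ right-leaf₀) = ⊥-elim (<-irrefl refl ℓ+1<x)
  right-leaf-neighbour ℓ+1<x (inj₁ right-leaf₁) = ⊥-elim (<-irrefl refl ℓ+1<x)
  right-leaf-neighbour ℓ+1<x (inj₂ (left-leaf _)) = ⊥-elim (<⇒≱ ℓ+1<x (s≤s (s≤s z≤n)))
  right-leaf-neighbour ℓ+1<x (inj₂ (along-path _ y≤ℓ)) = ⊥-elim (<⇒≱ ℓ+1<x (s≤s y≤ℓ))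
  right-leaf-neighbour _ (inj₂ right-leaf₀) = refl
  right-leaf-neighbour _ (inj₂ right-leaf₁) = refl

  second-neighbour : ∀ {y} → Adjacent 2 y → y ≤ 1 ⊎ y ≡ 3
  second-neighbour (inj₁ (along-path _ _)) = inj₂ refl
  second-neighbour (inj₂ (left-leaf y≤1)) = inj₁ y≤1
  second-neighbour (inj₁ (left-leaf (s≤s ())))
  second-neighbour (inj₂ (along-path (s≤s ()) _))

  inner-neighbour : ∀ {p y} → 3 ≤ p → p ≤ ℓ → Adjacent p y → suc y ≡ p ⊎ y ≡ suc p
  inner-neighbour 3≤p _ (inj₁ (left-leaf p≤1)) = ⊥-elim (≤⇒≯ p≤1 (≤-trans (s≤s (s≤s z≤n)) 3≤p))
  inner-neighbour _ _ (inj₁ (along-path _ _)) = inj₂ refl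
  inner-neighbour _ p≤ℓ (inj₁ right-leaf₀) = ⊥-elim (<-irrefl refl p≤ℓ)
  inner-neighbour _ p≤ℓ (inj₁ right-leaf₁) = ⊥-elim (<-irrefl refl p≤ℓ)
  inner-neighbour (s≤s (s≤s ())) _ (inj₂ (left-leaf _))
  inner-neighbour _ _ (inj₂ (along-path _ _)) = inj₁ refl
  inner-neighbour _ p≤ℓ (inj₂ right-leaf₀) = ⊥-elim (<-irrefl refl (≤-trans (n≤1+n _) p≤ℓ))
  inner-neighbour _ p≤ℓ (inj₂ right-leaf₁) =
    ⊥-elim (<-irrefl refl (≤-trans (≤-trans (n≤1+n _) (n≤1+n _)) p≤ℓ))

  last-neighbour : ∀ {y} → Adjacent (suc ℓ) y → y ≡ ℓ ⊎ y ≡ 2 + ℓ ⊎ y ≡ 3 + ℓ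
  last-neighbour (inj₁ (along-path _ ℓ+1≤ℓ)) = ⊥-elim (<-irrefl refl ℓ+1≤ℓ)
  last-neighbour (inj₁ right-leaf₀) = inj₂ (inj₁ refl)
  last-neighbour (inj₁ right-leaf₁) = inj₂ (inj₂ refl)
  last-neighbour (inj₁ (left-leaf (s≤s ())))
  last-neighbour (inj₂ e) = from-below e refl
    where
      from-below : ∀ {x y} → Edge y x → x ≡ suc ℓ → y ≡ ℓ ⊎ y ≡ 2 + ℓ ⊎ y ≡ 3 + ℓ
      from-below (left-leaf _) ()
      from-below (along-path _ _) x≡1+ℓ = inj₁ (suc-injective x≡1+ℓ)
      from-below right-leaf₀ x≡1+ℓ = ⊥-elim (<-irrefl (sym x≡1+ℓ) (n<1+n _))
      from-below right-leaf₁ x≡1+ℓ = ⊥-elim (<-irrefl (sym x≡1+ℓ) (≤-trans (n<1+n _) (n≤1+n _)))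

  edge-bounded : ∀ {x y} → Edge x y → x < N × y < N
  edge-bounded (left-leaf x≤1) = ≤-trans (s≤s x≤1) (s≤s (s≤s z≤n)) , s≤s (s≤s (s≤s z≤n))
  edge-bounded (along-path _ x≤ℓ) = s≤s (≤-trans x≤ℓ (≤-trans (n≤1+n _) (≤-trans (n≤1+n _) (n≤1+n _)))) ,
                                    s≤s (s≤s (≤-trans x≤ℓ (≤-trans (n≤1+n _) (n≤1+n _))))
  edge-bounded right-leaf₀ = s≤s (s≤s (≤-trans (n≤1+n _) (n≤1+n _))) , s≤s (s≤s (n≤1+n _))
  edge-bounded right-leaf₁ = s≤s (s≤s (≤-trans (n≤1+n _) (n≤1+n _))) , ≤-refl

  adjacent-bounded : ∀ {x y} → Adjacent x y → y < N
  adjacent-bounded (inj₁ e) = proj₂ (edge-bounded e)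
  adjacent-bounded (inj₂ e) = proj₁ (edge-bounded e)

  data Position : ℕ → Set where
    left₀  : Position 0
    left₁  : Position 1
    onPath : ∀ z → z < ℓ → Position (2 + z)
    right₀ : Position (2 + ℓ)
    right₁ : Position (3 + ℓ)

  position : ∀ x → x < N → Position x
  position zero _ = left₀
  position (suc zero) _ = left₁
  position (suc (suc z)) x<N with z <? ℓ
  ... | yes z<ℓ = onPath z z<ℓ
  ... | no z≮ℓ with z ≟ ℓ
  ...   | yes refl = right₀
  ...   | no z≢ℓ = subst (Position ∘′ suc ∘′ suc) (sym z≡1+ℓ) right₁
    where
      z≡1+ℓ : z ≡ suc ℓ
      z≡1+ℓ = ≤-antisym (s≤s⁻¹ (s≤s⁻¹ (s≤s⁻¹ x<N))) (≤∧≢⇒< (≮⇒≥ z≮ℓ) (z≢ℓ ∘′ sym))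

  tab : (ℕ → Bool) → Labeling N
  tab f = tabulate (f ∘′ toℕ)

  UniqueLabelledNeighbour : (ℕ → Bool) → ℕ → Set
  UniqueLabelledNeighbour f p =
    Σ ℕ λ q → Adjacent p q × f q ≡ true × (∀ y → Adjacent p y → f y ≡ true → y ≡ q)

  flip-move : ∀ {f g : ℕ → Bool} {p} → p < N → UniqueLabelledNeighbour f p →
    g p ≡ not (f p) → (∀ x → x < N → x ≢ p → g x ≡ f x) → OneMove D (tab f) (tab g)
  flip-move {f} {g} {p} p<N (q , pq , fq , only-q) gp g-elsewhere =
    unique-neighbour-flip D (f ∘′ toℕ) (g ∘′ toℕ) i w iw only-w
      (subst (λ x → g x ≡ not (f x)) (sym i≡p) gp)
      (λ j j≢i → g-elsewhere (toℕ j) (Fin.toℕ<n j) (λ j≡p → j≢i (Fin.toℕ-injective (trans j≡p (sym i≡p)))))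
    where
      i w : Fin N
      i = fromℕ< p<N
      w = fromℕ< (adjacent-bounded pq)
      i≡p : toℕ i ≡ p
      i≡p = Fin.toℕ-fromℕ< p<N
      w≡q : toℕ w ≡ q
      w≡q = Fin.toℕ-fromℕ< (adjacent-bounded pq)
      iw : D i w ∧ f (toℕ w) ≡ true
      iw rewrite D-complete i w (subst₂ Adjacent (sym i≡p) (sym w≡q) pq) = trans (cong f w≡q) fq
      only-w : ∀ j → D i j ∧ f (toℕ j) ≡ true → j ≡ w
      only-w j ij = let (Dij , fj) = ∧-true ij
                        ij-adjacent = subst (λ x → Adjacent x (toℕ j)) i≡p (D-sound i j Dij) in
        Fin.toℕ-injective (trans (only-q (toℕ j) ij-adjacent fj) (sym w≡q))

  -- The path labels 1010… with the first d of them flipped, and the four leaf labels.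
  pathLabel : ℕ → ℕ → Bool
  pathLabel d z = even z xor (z <ᵇ d)

  sweep : ℕ → Bool → Bool → Bool → Bool → ℕ → Bool
  sweep d x₀ x₁ y₀ y₁ zero = x₀
  sweep d x₀ x₁ y₀ y₁ (suc zero) = x₁
  sweep d x₀ x₁ y₀ y₁ (suc (suc z)) = if z <ᵇ ℓ then pathLabel d z else if z ≡ᵇ ℓ then y₀ else y₁

  sweepAt : ℕ → Bool → Bool → Bool → Bool → ∀ {x} → Position x → Bool
  sweepAt d x₀ x₁ y₀ y₁ left₀ = x₀
  sweepAt d x₀ x₁ y₀ y₁ left₁ = x₁
  sweepAt d x₀ x₁ y₀ y₁ (onPath z _) = pathLabel d z
  sweepAt d x₀ x₁ y₀ y₁ right₀ = y₀
  sweepAt d x₀ x₁ y₀ y₁ right₁ = y₁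

  sweep-position : ∀ d x₀ x₁ y₀ y₁ {x} (pos : Position x) → sweep d x₀ x₁ y₀ y₁ x ≡ sweepAt d x₀ x₁ y₀ y₁ pos
  sweep-position d x₀ x₁ y₀ y₁ left₀ = refl
  sweep-position d x₀ x₁ y₀ y₁ left₁ = refl
  sweep-position d x₀ x₁ y₀ y₁ (onPath z z<ℓ) rewrite <ᵇ-true z<ℓ = refl
  sweep-position d x₀ x₁ y₀ y₁ right₀ rewrite <ᵇ-false (≤-refl {ℓ}) | ≡ᵇ-refl ℓ = refl
  sweep-position d x₀ x₁ y₀ y₁ right₁ rewrite <ᵇ-false (n≤1+n ℓ) | ≡ᵇ-false (1+n≢n {ℓ}) = refl

  sweep-agree : ∀ d x₀ x₁ y₀ y₁ d′ x₀′ x₁′ y₀′ y₁′ {e} →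
    (∀ {x} (pos : Position x) → x ≢ e →
       sweepAt d′ x₀′ x₁′ y₀′ y₁′ pos ≡ sweepAt d x₀ x₁ y₀ y₁ pos) →
    ∀ x → x < N → x ≢ e → sweep d′ x₀′ x₁′ y₀′ y₁′ x ≡ sweep d x₀ x₁ y₀ y₁ x
  sweep-agree d x₀ x₁ y₀ y₁ d′ x₀′ x₁′ y₀′ y₁′ agree x x<N x≢e =
    trans (sweep-position d′ x₀′ x₁′ y₀′ y₁′ pos)
          (trans (agree pos x≢e) (sym (sweep-position d x₀ x₁ y₀ y₁ pos)))
    where pos = position x x<N

  sweep-flipped : ∀ d x₀ x₁ y₀ y₁ {z} → z < ℓ → z < d → sweep d x₀ x₁ y₀ y₁ (2 + z) ≡ not (even z)
  sweep-flipped d x₀ x₁ y₀ y₁ {z} z<ℓ z<d =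
    trans (sweep-position d x₀ x₁ y₀ y₁ (onPath z z<ℓ))
          (trans (cong (even z xor_) (<ᵇ-true z<d)) (xor-true (even z)))

  sweep-unflipped : ∀ d x₀ x₁ y₀ y₁ {z} → z < ℓ → d ≤ z → sweep d x₀ x₁ y₀ y₁ (2 + z) ≡ even z
  sweep-unflipped d x₀ x₁ y₀ y₁ {z} z<ℓ d≤z =
    trans (sweep-position d x₀ x₁ y₀ y₁ (onPath z z<ℓ))
          (trans (cong (even z xor_) (<ᵇ-false d≤z)) (xor-identityʳ (even z)))

  pathLabel-suc : ∀ {d z} → suc z ≢ d → pathLabel d (suc z) ≡ not (pathLabel d z)
  pathLabel-suc {d} {z} 1+z≢d =
    trans (cong₂ _xor_ (even-suc z) (suc-<ᵇ 1+z≢d)) (sym (not-distribˡ-xor (even z) (z <ᵇ d)))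

  flip-left₀ : ∀ x₀ x₁ y₀ y₁ → OneMove D (tab (sweep 0 x₀ x₁ y₀ y₁)) (tab (sweep 0 (not x₀) x₁ y₀ y₁))
  flip-left₀ x₀ x₁ y₀ y₁ =
    flip-move z<s (2 , inj₁ (left-leaf z≤n) , refl , λ _ adj _ → left-leaf-neighbour z≤n adj) refl elsewhere
    where
      elsewhere : ∀ x → x < N → x ≢ 0 → sweep 0 (not x₀) x₁ y₀ y₁ x ≡ sweep 0 x₀ x₁ y₀ y₁ x
      elsewhere zero _ x≢0 = ⊥-elim (x≢0 refl)
      elsewhere (suc zero) _ _ = refl
      elsewhere (suc (suc _)) _ _ = refl

  flip-left₁ : ∀ x₀ x₁ y₀ y₁ → OneMove D (tab (sweep 0 x₀ x₁ y₀ y₁)) (tab (sweep 0 x₀ (not x₁) y₀ y₁))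
  flip-left₁ x₀ x₁ y₀ y₁ =
    flip-move (s<s z<s) (2 , inj₁ (left-leaf ≤-refl) , refl , λ _ adj _ → left-leaf-neighbour ≤-refl adj)
      refl elsewhere
    where
      elsewhere : ∀ x → x < N → x ≢ 1 → sweep 0 x₀ (not x₁) y₀ y₁ x ≡ sweep 0 x₀ x₁ y₀ y₁ x
      elsewhere zero _ _ = refl
      elsewhere (suc zero) _ x≢1 = ⊥-elim (x≢1 refl)
      elsewhere (suc (suc _)) _ _ = refl

  last-path-vertex : ∀ x₀ x₁ y₀ y₁ → sweep ℓ x₀ x₁ y₀ y₁ (suc ℓ) ≡ true
  last-path-vertex x₀ x₁ y₀ y₁ =
    trans (sweep-position ℓ x₀ x₁ y₀ y₁ (onPath _ ≤-refl))
          (cong₂ _xor_ (trans (even-suc (m + m)) (cong not (even-double m))) (<ᵇ-true {suc (m + m)} ≤-refl))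

  flip-right₀ : ∀ x₀ x₁ y₀ y₁ → OneMove D (tab (sweep ℓ x₀ x₁ y₀ y₁)) (tab (sweep ℓ x₀ x₁ (not y₀) y₁))
  flip-right₀ x₀ x₁ y₀ y₁ =
    flip-move (s≤s (n≤1+n _)) (suc ℓ , inj₂ right-leaf₀ , last-path-vertex x₀ x₁ y₀ y₁ ,
                               λ _ adj _ → right-leaf-neighbour ≤-refl adj)
      (trans (sweep-position ℓ x₀ x₁ (not y₀) y₁ right₀)
             (cong not (sym (sweep-position ℓ x₀ x₁ y₀ y₁ right₀))))
      (sweep-agree ℓ x₀ x₁ y₀ y₁ ℓ x₀ x₁ (not y₀) y₁ agree)
    where
      agree : ∀ {x} (pos : Position x) → x ≢ 2 + ℓ →
              sweepAt ℓ x₀ x₁ (not y₀) y₁ pos ≡ sweepAt ℓ x₀ x₁ y₀ y₁ pos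
      agree left₀ _ = refl
      agree left₁ _ = refl
      agree (onPath _ _) _ = refl
      agree right₀ x≢2+ℓ = ⊥-elim (x≢2+ℓ refl)
      agree right₁ _ = refl

  flip-right₁ : ∀ x₀ x₁ y₀ y₁ → OneMove D (tab (sweep ℓ x₀ x₁ y₀ y₁)) (tab (sweep ℓ x₀ x₁ y₀ (not y₁)))
  flip-right₁ x₀ x₁ y₀ y₁ =
    flip-move ≤-refl (suc ℓ , inj₂ right-leaf₁ , last-path-vertex x₀ x₁ y₀ y₁ ,
                      λ _ adj _ → right-leaf-neighbour (s≤s (n≤1+n _)) adj)
      (trans (sweep-position ℓ x₀ x₁ y₀ (not y₁) right₁)
             (cong not (sym (sweep-position ℓ x₀ x₁ y₀ y₁ right₁))))
      (sweep-agree ℓ x₀ x₁ y₀ y₁ ℓ x₀ x₁ y₀ (not y₁) agree)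
    where
      agree : ∀ {x} (pos : Position x) → x ≢ 3 + ℓ →
              sweepAt ℓ x₀ x₁ y₀ (not y₁) pos ≡ sweepAt ℓ x₀ x₁ y₀ y₁ pos
      agree left₀ _ = refl
      agree left₁ _ = refl
      agree (onPath _ _) _ = refl
      agree right₀ _ = refl
      agree right₁ x≢3+ℓ = ⊥-elim (x≢3+ℓ refl)

  one-of-two-labelled : ∀ {f p q r} → Adjacent p q → Adjacent p r → f q ≡ not (f r) →
    (∀ y → Adjacent p y → f y ≡ true → y ≡ q ⊎ y ≡ r) → UniqueLabelledNeighbour f p
  one-of-two-labelled {f} {q = q} {r} pq pr fq≡ among with f r in fr
  ... | true = r , pr , fr , only-r
    where
      only-r : ∀ y → _ → f y ≡ true → y ≡ r
      only-r y py fy with among y py fy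
      ... | inj₁ refl = case trans (sym fy) fq≡ of λ ()
      ... | inj₂ y≡r = y≡r
  ... | false = q , pq , fq≡ , only-q
    where
      only-q : ∀ y → _ → f y ≡ true → y ≡ q
      only-q y py fy with among y py fy
      ... | inj₁ y≡q = y≡q
      ... | inj₂ refl = case trans (sym fy) fr of λ ()

  second-has-unique-neighbour : ∀ x₀ x₁ y₀ y₁ → x₀ xor x₁ ≡ true →
                                UniqueLabelledNeighbour (sweep 0 x₀ x₁ y₀ y₁) 2
  second-has-unique-neighbour x₀ x₁ y₀ y₁ x-odd =
    one-of-two-labelled (inj₂ (left-leaf z≤n)) (inj₂ (left-leaf ≤-refl)) (xor≡true⇒≡not x-odd) among
    where
      among : ∀ y → Adjacent 2 y → sweep 0 x₀ x₁ y₀ y₁ y ≡ true → y ≡ 0 ⊎ y ≡ 1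
      among y adj fy with second-neighbour adj
      ... | inj₁ z≤n = inj₁ refl
      ... | inj₁ (s≤s z≤n) = inj₂ refl
      ... | inj₂ refl = case fy of λ ()

  inner-has-unique-neighbour : ∀ d x₀ x₁ y₀ y₁ → suc (suc d) < ℓ →
                               UniqueLabelledNeighbour (sweep (suc d) x₀ x₁ y₀ y₁) (3 + d)
  inner-has-unique-neighbour d x₀ x₁ y₀ y₁ 2+d<ℓ =
    one-of-two-labelled (inj₂ (along-path (s≤s (s≤s z≤n)) (<⇒≤ 2+d<ℓ)))
                        (inj₁ (along-path (s≤s (s≤s z≤n)) 2+d<ℓ))
      (trans (sweep-flipped (suc d) x₀ x₁ y₀ y₁ d<ℓ (n<1+n d))
             (cong not (sym (sweep-unflipped (suc d) x₀ x₁ y₀ y₁ 2+d<ℓ (n≤1+n (suc d))))))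
      (λ y adj _ → ⊎-map (suc-injective) id (inner-neighbour (s≤s (s≤s (s≤s z≤n))) 2+d<ℓ adj))
    where
      d<ℓ : d < ℓ
      d<ℓ = <-trans (n<1+n d) (<-trans (n<1+n _) 2+d<ℓ)

  last-has-unique-neighbour : ∀ x₀ x₁ y₀ y₁ → y₀ xor y₁ ≡ true →
                              UniqueLabelledNeighbour (sweep (suc (m + m)) x₀ x₁ y₀ y₁) (suc ℓ)
  last-has-unique-neighbour x₀ x₁ y₀ y₁ y-odd =
    one-of-two-labelled (inj₁ right-leaf₀) (inj₁ right-leaf₁)
      (trans (sweep-position (suc (m + m)) x₀ x₁ y₀ y₁ right₀)
             (trans (xor≡true⇒≡not y-odd) (cong not (sym (sweep-position (suc (m + m)) x₀ x₁ y₀ y₁ right₁)))))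
      among
    where
      among : ∀ y → Adjacent (suc ℓ) y → sweep (suc (m + m)) x₀ x₁ y₀ y₁ y ≡ true → y ≡ 2 + ℓ ⊎ y ≡ 3 + ℓ
      among y adj fy with last-neighbour adj
      ... | inj₁ refl = case trans (sym fy) second-last-unlabelled of λ ()
        where
          second-last-unlabelled : sweep (suc (m + m)) x₀ x₁ y₀ y₁ ℓ ≡ false
          second-last-unlabelled =
            trans (sweep-flipped _ x₀ x₁ y₀ y₁ {m + m} (<-trans (n<1+n _) (n<1+n _)) (n<1+n _))
                  (cong not (even-double m))
      ... | inj₂ y≡ = y≡

  step-has-unique-neighbour : ∀ d x₀ x₁ y₀ y₁ → d < ℓ → x₀ xor x₁ ≡ true → y₀ xor y₁ ≡ true →
                              UniqueLabelledNeighbour (sweep d x₀ x₁ y₀ y₁) (2 + d)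
  step-has-unique-neighbour zero x₀ x₁ y₀ y₁ _ x-odd _ = second-has-unique-neighbour x₀ x₁ y₀ y₁ x-odd
  step-has-unique-neighbour (suc d) x₀ x₁ y₀ y₁ d<ℓ _ y-odd with suc (suc d) ≟ ℓ
  ... | yes refl = last-has-unique-neighbour x₀ x₁ y₀ y₁ y-odd
  ... | no d≢ = inner-has-unique-neighbour d x₀ x₁ y₀ y₁ (≤∧≢⇒< d<ℓ d≢)

  sweep-step : ∀ d x₀ x₁ y₀ y₁ → d < ℓ → x₀ xor x₁ ≡ true → y₀ xor y₁ ≡ true →
               OneMove D (tab (sweep d x₀ x₁ y₀ y₁)) (tab (sweep (suc d) x₀ x₁ y₀ y₁))
  sweep-step d x₀ x₁ y₀ y₁ d<ℓ x-odd y-odd =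
    flip-move (s≤s (s≤s (≤-trans d<ℓ (≤-trans (n≤1+n ℓ) (n≤1+n _)))))
      (step-has-unique-neighbour d x₀ x₁ y₀ y₁ d<ℓ x-odd y-odd)
      (trans (sweep-flipped (suc d) x₀ x₁ y₀ y₁ d<ℓ (n<1+n d))
             (cong not (sym (sweep-unflipped d x₀ x₁ y₀ y₁ d<ℓ ≤-refl))))
      (sweep-agree d x₀ x₁ y₀ y₁ (suc d) x₀ x₁ y₀ y₁ agree)
    where
      agree : ∀ {x} (pos : Position x) → x ≢ 2 + d →
              sweepAt (suc d) x₀ x₁ y₀ y₁ pos ≡ sweepAt d x₀ x₁ y₀ y₁ pos
      agree left₀ _ = refl
      agree left₁ _ = refl
      agree (onPath z _) z≢d = cong (even z xor_) (<ᵇ-suc (z≢d ∘′ cong (suc ∘′ suc)))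
      agree right₀ _ = refl
      agree right₁ _ = refl

  _≈_ : Labeling N → Labeling N → Set
  _≈_ = Equivalent D

  ≈-sym : ∀ {a b} → a ≈ b → b ≈ a
  ≈-sym = reverse λ where
    (i , inj₁ e) → i , inj₂ e
    (i , inj₂ e) → i , inj₁ e

  sweep-along : ∀ d x₀ x₁ y₀ y₁ → d ≤ ℓ → x₀ xor x₁ ≡ true → y₀ xor y₁ ≡ true →
                tab (sweep 0 x₀ x₁ y₀ y₁) ≈ tab (sweep d x₀ x₁ y₀ y₁)
  sweep-along zero x₀ x₁ y₀ y₁ _ _ _ = ε
  sweep-along (suc d) x₀ x₁ y₀ y₁ d<ℓ x-odd y-odd =
    sweep-along d x₀ x₁ y₀ y₁ (<⇒≤ d<ℓ) x-odd y-odd ◅◅ sweep-step d x₀ x₁ y₀ y₁ d<ℓ x-odd y-odd ◅ ε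

  normalise-left : ∀ x₀ x₁ y₀ y₁ → tab (sweep 0 x₀ x₁ y₀ y₁) ≈ tab (sweep 0 true false y₀ y₁)
  normalise-left true false y₀ y₁ = ε
  normalise-left false false y₀ y₁ = flip-left₀ false false y₀ y₁ ◅ ε
  normalise-left true true y₀ y₁ = flip-left₁ true true y₀ y₁ ◅ ε
  normalise-left false true y₀ y₁ = flip-left₀ false true y₀ y₁ ◅ flip-left₁ true true y₀ y₁ ◅ ε

  normalise-right : ∀ x₀ x₁ y₀ y₁ → tab (sweep ℓ x₀ x₁ y₀ y₁) ≈ tab (sweep ℓ x₀ x₁ false true)
  normalise-right x₀ x₁ false true = ε
  normalise-right x₀ x₁ true true = flip-right₀ x₀ x₁ true true ◅ ε
  normalise-right x₀ x₁ false false = flip-right₁ x₀ x₁ false false ◅ ε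
  normalise-right x₀ x₁ true false = flip-right₀ x₀ x₁ true false ◅ flip-right₁ x₀ x₁ false false ◅ ε

  canonical : Labeling N
  canonical = tab (sweep 0 true false false true)

  fully-swept-≈-canonical : ∀ x₀ x₁ y₀ y₁ → x₀ xor x₁ ≡ true → tab (sweep ℓ x₀ x₁ y₀ y₁) ≈ canonical
  fully-swept-≈-canonical x₀ x₁ y₀ y₁ x-odd =
    normalise-right x₀ x₁ y₀ y₁
    ◅◅ ≈-sym (sweep-along ℓ x₀ x₁ false true ≤-refl x-odd refl)
    ◅◅ normalise-left x₀ x₁ false true

  unswept-≈-canonical : ∀ x₀ x₁ y₀ y₁ → y₀ xor y₁ ≡ true → tab (sweep 0 x₀ x₁ y₀ y₁) ≈ canonical
  unswept-≈-canonical x₀ x₁ y₀ y₁ y-odd =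
    normalise-left x₀ x₁ y₀ y₁
    ◅◅ sweep-along ℓ true false y₀ y₁ ≤-refl refl y-odd
    ◅◅ fully-swept-≈-canonical true false y₀ y₁ refl

  Whole : Fin N → Bool
  Whole _ = true

  Path : Fin N → Bool
  Path = pathD n

  on-path : ∀ v → 2 ≤ toℕ v → toℕ v ≤ suc ℓ → Path v ≡ true
  on-path v 2≤v v≤1+ℓ rewrite ≤ᵇ-true 2≤v | ≤ᵇ-true v≤1+ℓ = refl

  path-bounds : ∀ (a : Labeling N) v → Labelled Path a v → 2 ≤ toℕ v × toℕ v ≤ suc ℓ
  path-bounds a v lv = let (2≤v , v≤1+ℓ) = ∧-true (proj₁ (∧-true lv)) in
    ≤ᵇ⇒≤ 2 (toℕ v) (Equivalence.from T-≡ 2≤v) , ≤ᵇ⇒≤ (toℕ v) (suc ℓ) (Equivalence.from T-≡ v≤1+ℓ)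

  path-labelled : ∀ (a : Labeling N) v → Labelled Path a v → label a (toℕ v) ≡ true
  path-labelled a v lv = trans (sym (lookup≡label a v)) (proj₂ (∧-true lv))

  path-consecutive : ∀ S a → (∀ v → Labelled S a v → 2 ≤ toℕ v × toℕ v ≤ suc ℓ) → ConsecutiveAdjacent D S a
  path-consecutive S a within u v lu lv v≡1+u =
    D-complete u v (inj₁ (subst (Edge (toℕ u)) (sym v≡1+u) (along-path (proj₁ (within u lu)) u≤ℓ)))
    where
      u≤ℓ : toℕ u ≤ ℓ
      u≤ℓ = s≤s⁻¹ (subst (_≤ suc ℓ) v≡1+u (proj₂ (within v lv)))

  labels-differ : ∀ (a : Labeling N) {x y} → label a x ≡ true → label a y ≡ false → x ≢ y
  labels-differ a ax ay refl = case trans (sym ax) ay of λ ()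

  path-position : ∀ {x} → Position x → x ≢ 0 → x ≢ 1 → x ≢ 2 + ℓ → x ≢ 3 + ℓ → 2 ≤ x × x ≤ suc ℓ
  path-position left₀ x≢0 _ _ _ = ⊥-elim (x≢0 refl)
  path-position left₁ _ x≢1 _ _ = ⊥-elim (x≢1 refl)
  path-position (onPath z z<ℓ) _ _ _ _ = s≤s (s≤s z≤n) , s≤s z<ℓ
  path-position right₀ _ _ x≢2+ℓ _ = ⊥-elim (x≢2+ℓ refl)
  path-position right₁ _ _ _ x≢3+ℓ = ⊥-elim (x≢3+ℓ refl)

  some-leaf-labelled : ∀ a → HasComponents D a (suc (suc m)) →
    label a 0 ≡ true ⊎ label a 1 ≡ true ⊎ label a (2 + ℓ) ≡ true ⊎ label a (3 + ℓ) ≡ true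
  some-leaf-labelled a hw
    with label a 0 in a₀ | label a 1 in a₁ | label a (2 + ℓ) in a₂ | label a (3 + ℓ) in a₃
  ... | true | _ | _ | _ = inj₁ refl
  ... | false | true | _ | _ = inj₂ (inj₁ refl)
  ... | false | false | true | _ = inj₂ (inj₂ (inj₁ refl))
  ... | false | false | false | true = inj₂ (inj₂ (inj₂ refl))
  ... | false | false | false | false =
    ⊥-elim (1+n≰n (segment-components-≤ D-sym Whole a (path-consecutive Whole a within′) 2 (suc m) hw within))
    where
      within′ : ∀ v → Labelled Whole a v → 2 ≤ toℕ v × toℕ v ≤ suc ℓ
      within′ v lv = path-position (position (toℕ v) (Fin.toℕ<n v))
        (labels-differ a av a₀) (labels-differ a av a₁) (labels-differ a av a₂) (labels-differ a av a₃)
        where av = trans (sym (lookup≡label a v)) lv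
      within : LabelledWithin Whole a 2 (suc m + suc m)
      within v lv =
        proj₁ (within′ v lv) , subst (λ l → toℕ v < 2 + l) (sym (suc+suc m)) (s≤s (proj₂ (within′ v lv)))

  path-ends-not-both-unlabelled : ∀ a → HasComponentsOn D Path a (suc m) →
                                  label a 2 ≡ false → label a (suc ℓ) ≡ false → ⊥
  path-ends-not-both-unlabelled a hp a₂ a₃ =
    1+n≰n (segment-components-≤ D-sym Path a (path-consecutive Path a (path-bounds a)) 3 m hp within)
    where
      within : LabelledWithin Path a 3 (m + m)
      within v lv = let (2≤v , v≤1+ℓ) = path-bounds a v lv ; av = path-labelled a v lv in
        ≤∧≢⇒< 2≤v (labels-differ a av a₂ ∘′ sym) , ≤∧≢⇒< v≤1+ℓ (labels-differ a av a₃)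

  path-alternates : ∀ a s → 2 ≤ s → s ≤ 3 → HasComponentsOn D Path a (suc m) →
    LabelledWithin Path a s (suc (m + m)) → ∀ x → s ≤ x → x < s + suc (m + m) → label a x ≡ even (x ∸ s)
  path-alternates a s 2≤s s≤3 hp within x s≤x x<end = begin
    label a x               ≡⟨ cong (label a) (sym w≡x) ⟩
    label a (toℕ w)         ≡⟨ sym (lookup≡label a w) ⟩
    lookup a w              ≡⟨ cong (_∧ lookup a w) (sym (on-path w (≤-trans 2≤s s≤w) w≤1+ℓ)) ⟩
    Path w ∧ lookup a w     ≡⟨ alternation w s≤w (subst (_< s + suc (m + m)) (sym w≡x) x<end) ⟩
    even (toℕ w ∸ s)        ≡⟨ cong (even ∘′ (_∸ s)) w≡x ⟩
    even (x ∸ s)            ∎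
    where
      open ≡-Reasoning
      alternation = segment-alternates D-sym Path a (path-consecutive Path a (path-bounds a)) s m hp within
      x≤1+ℓ : x ≤ suc ℓ
      x≤1+ℓ = s≤s⁻¹ (≤-trans x<end (+-monoˡ-≤ (suc (m + m)) s≤3))
      x<N : x < N
      x<N = ≤-trans (s≤s x≤1+ℓ) (≤-trans (n≤1+n _) (n≤1+n _))
      w : Fin N
      w = fromℕ< x<N
      w≡x : toℕ w ≡ x
      w≡x = Fin.toℕ-fromℕ< x<N
      s≤w : s ≤ toℕ w
      s≤w = subst (s ≤_) (sym w≡x) s≤x
      w≤1+ℓ : toℕ w ≤ suc ℓ
      w≤1+ℓ = subst (_≤ suc ℓ) (sym w≡x) x≤1+ℓ

  as-sweep : ∀ a d → (∀ z → z < ℓ → label a (2 + z) ≡ pathLabel d z) →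
             a ≡ tab (sweep d (label a 0) (label a 1) (label a (2 + ℓ)) (label a (3 + ℓ)))
  as-sweep a d on-path-labels = label-ext a _ λ x x<N → at (position x x<N)
    where
      a₀ = label a 0
      a₁ = label a 1
      a₂ = label a (2 + ℓ)
      a₃ = label a (3 + ℓ)
      at : ∀ {x} → Position x → label a x ≡ sweep d a₀ a₁ a₂ a₃ x
      at left₀ = refl
      at left₁ = refl
      at (onPath z z<ℓ) = trans (on-path-labels z z<ℓ) (sym (sweep-position d a₀ a₁ a₂ a₃ (onPath z z<ℓ)))
      at right₀ = sym (sweep-position d a₀ a₁ a₂ a₃ right₀)
      at right₁ = sym (sweep-position d a₀ a₁ a₂ a₃ right₁)

  unswept-form : ∀ a → HasComponentsOn D Path a (suc m) → label a (suc ℓ) ≡ false →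
                 a ≡ tab (sweep 0 (label a 0) (label a 1) (label a (2 + ℓ)) (label a (3 + ℓ)))
  unswept-form a hp a₃ = as-sweep a 0 labels
    where
      within : LabelledWithin Path a 2 (suc (m + m))
      within v lv = let (2≤v , v≤1+ℓ) = path-bounds a v lv in
        2≤v , ≤∧≢⇒< v≤1+ℓ (labels-differ a (path-labelled a v lv) a₃)
      labels : ∀ z → z < ℓ → label a (2 + z) ≡ pathLabel 0 z
      labels z z<ℓ with m<1+n⇒m<n∨m≡n z<ℓ
      ... | inj₁ z<ℓ-1 =
        trans (path-alternates a 2 ≤-refl (n≤1+n 2) hp within (2 + z) (s≤s (s≤s z≤n)) (s≤s (s≤s z<ℓ-1)))
              (sym (xor-identityʳ (even z)))
      ... | inj₂ refl =
        trans a₃ (sym (cong (_xor false) (trans (even-suc (m + m)) (cong not (even-double m)))))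

  swept-form : ∀ a → HasComponentsOn D Path a (suc m) → label a 2 ≡ false →
               a ≡ tab (sweep ℓ (label a 0) (label a 1) (label a (2 + ℓ)) (label a (3 + ℓ)))
  swept-form a hp a₂ = as-sweep a ℓ labels
    where
      within : LabelledWithin Path a 3 (suc (m + m))
      within v lv = let (2≤v , v≤1+ℓ) = path-bounds a v lv in
        ≤∧≢⇒< 2≤v (labels-differ a (path-labelled a v lv) a₂ ∘′ sym) , s≤s v≤1+ℓ
      labels : ∀ z → z < ℓ → label a (2 + z) ≡ pathLabel ℓ z
      labels zero _ = a₂
      labels (suc z) 1+z<ℓ =
        trans (path-alternates a 3 (n≤1+n 2) ≤-refl hp within (3 + z) (s≤s (s≤s (s≤s z≤n)))
                               (s≤s (s≤s (s≤s (s≤s⁻¹ 1+z<ℓ)))))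
              (trans (sym (not-involutive (even z)))
                     (trans (cong not (sym (even-suc z)))
                            (sym (trans (cong (even (suc z) xor_) (<ᵇ-true 1+z<ℓ)) (xor-true _)))))

  attachment : ∀ {x} → Position x → ℕ
  attachment left₀ = 2
  attachment left₁ = 2
  attachment (onPath z _) = 2 + z
  attachment right₀ = suc ℓ
  attachment right₁ = suc ℓ

  attachment-on-path : ∀ {x} (pos : Position x) → 2 ≤ attachment pos × attachment pos ≤ suc ℓ
  attachment-on-path left₀ = ≤-refl , s≤s (s≤s z≤n)
  attachment-on-path left₁ = ≤-refl , s≤s (s≤s z≤n)
  attachment-on-path (onPath z z<ℓ) = s≤s (s≤s z≤n) , s≤s z<ℓ
  attachment-on-path right₀ = s≤s (s≤s z≤n) , ≤-refl
  attachment-on-path right₁ = s≤s (s≤s z≤n) , ≤-refl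

  attachment-adjacent : ∀ {x} (pos : Position x) → attachment pos ≡ x ⊎ Adjacent x (attachment pos)
  attachment-adjacent left₀ = inj₂ (inj₁ (left-leaf z≤n))
  attachment-adjacent left₁ = inj₂ (inj₁ (left-leaf ≤-refl))
  attachment-adjacent (onPath z _) = inj₁ refl
  attachment-adjacent right₀ = inj₂ (inj₂ right-leaf₀)
  attachment-adjacent right₁ = inj₂ (inj₂ right-leaf₁)

  -- Every labelled leaf is joined to its labelled path neighbour, so each component meets the path.
  components-≤-path-components : ∀ a {c c′} → HasComponents D a c → HasComponentsOn D Path a c′ →
    (label a 0 ≡ true → label a 2 ≡ true) → (label a 1 ≡ true → label a 2 ≡ true) →
    (label a (2 + ℓ) ≡ true → label a (suc ℓ) ≡ true) → (label a (3 + ℓ) ≡ true → label a (suc ℓ) ≡ true) →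
    c ≤ c′
  components-≤-path-components a hw hp l₀ l₁ r₀ r₁ =
    components-≤-projection D Whole Path a D-sym hw hp (λ v lv → proj₂ (∧-true lv)) π projected
    where
      pos : (v : Fin N) → Position (toℕ v)
      pos v = position (toℕ v) (Fin.toℕ<n v)
      attachment-labelled : ∀ {x} (p : Position x) → label a x ≡ true → label a (attachment p) ≡ true
      attachment-labelled left₀ = l₀
      attachment-labelled left₁ = l₁
      attachment-labelled (onPath _ _) ax = ax
      attachment-labelled right₀ = r₀
      attachment-labelled right₁ = r₁
      attachment<N : ∀ {x} (p : Position x) → attachment p < N
      attachment<N p = s≤s (≤-trans (proj₂ (attachment-on-path p)) (≤-trans (n≤1+n _) (n≤1+n _)))
      π : Fin N → Fin N
      π v = fromℕ< (attachment<N (pos v))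
      π≡ : ∀ v → toℕ (π v) ≡ attachment (pos v)
      π≡ v = Fin.toℕ-fromℕ< (attachment<N (pos v))
      projected : ∀ v → Labelled Whole a v → Labelled Path a (π v) × ConnectedIn D Whole a v (π v)
      projected v lv = path-labelled-π , connected (attachment-adjacent (pos v))
        where
          lπ : lookup a (π v) ≡ true
          lπ = trans (lookup≡label a (π v)) (trans (cong (label a) (π≡ v))
                 (attachment-labelled (pos v) (trans (sym (lookup≡label a v)) lv)))
          path-labelled-π : Labelled Path a (π v)
          path-labelled-π
            rewrite on-path (π v) (subst (2 ≤_) (sym (π≡ v)) (proj₁ (attachment-on-path (pos v))))
                                  (subst (_≤ suc ℓ) (sym (π≡ v)) (proj₂ (attachment-on-path (pos v)))) = lπ
          connected : attachment (pos v) ≡ toℕ v ⊎ Adjacent (toℕ v) (attachment (pos v)) →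
                      ConnectedIn D Whole a v (π v)
          connected (inj₁ same) =
            subst (ConnectedIn D Whole a v) (Fin.toℕ-injective (trans (sym same) (sym (π≡ v)))) ε
          connected (inj₂ adj) =
            connected-edge D Whole a (D-complete v (π v) (subst (Adjacent (toℕ v)) (sym (π≡ v)) adj)) lv lπ

  ≤-components-of-tab : ∀ f {c d} → HasComponents D (tab f) c → (κ : ℕ → ℕ) →
    (∀ {x y} → Edge x y → f x ≡ true → f y ≡ true → κ x ≡ κ y) →
    (w : Fin d → ℕ) → (∀ i → w i < N) → (∀ i → f (w i) ≡ true) → Injective _≡_ _≡_ (κ ∘′ w) → d ≤ c
  ≤-components-of-tab f hc κ edge-invariant w w<N w-labelled κw-injective =
    ≤-components D Whole (tab f) hc e e-labelled separated
    where
      e : _ → Fin N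
      e i = fromℕ< (w<N i)
      f-label : ∀ v → lookup (tab f) v ≡ f (toℕ v)
      f-label = lookup∘tabulate (f ∘′ toℕ)
      e-labelled : ∀ i → Labelled Whole (tab f) (e i)
      e-labelled i = trans (f-label (e i)) (trans (cong f (Fin.toℕ-fromℕ< (w<N i))) (w-labelled i))
      invariant : ∀ {u v} → InducedEdge D Whole (tab f) u v → κ (toℕ u) ≡ κ (toℕ v)
      invariant {u} {v} (uv , lu , lv) with D-sound u v uv
      ... | inj₁ e = edge-invariant e (trans (sym (f-label u)) lu) (trans (sym (f-label v)) lv)
      ... | inj₂ e = sym (edge-invariant e (trans (sym (f-label v)) lv) (trans (sym (f-label u)) lu))
      separated : ∀ i j → ConnectedIn D Whole (tab f) (e i) (e j) → i ≡ j
      separated i j conn = κw-injective (trans (cong κ (sym (Fin.toℕ-fromℕ< (w<N i))))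
        (trans (connected-invariant D Whole (tab f) (κ ∘′ toℕ) invariant conn)
               (cong κ (Fin.toℕ-fromℕ< (w<N j)))))

  extreme-≢ : ∀ {d z} → d ≡ 0 ⊎ d ≡ ℓ → suc z < ℓ → suc z ≢ d
  extreme-≢ (inj₁ refl) _ ()
  extreme-≢ (inj₂ refl) 1+z<ℓ 1+z≡ℓ = <-irrefl 1+z≡ℓ 1+z<ℓ

  no-labelled-path-edge : ∀ d x₀ x₁ y₀ y₁ {x} → d ≡ 0 ⊎ d ≡ ℓ → 2 ≤ x → x ≤ ℓ →
    sweep d x₀ x₁ y₀ y₁ x ≡ true → sweep d x₀ x₁ y₀ y₁ (suc x) ≡ true → ⊥
  no-labelled-path-edge _ _ _ _ _ {suc zero} _ (s≤s ()) _ _ _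
  no-labelled-path-edge d x₀ x₁ y₀ y₁ {suc (suc z)} d≡0⊎ℓ _ 2+z≤ℓ fx fy =
    case trans (sym fy) (trans (sweep-position d x₀ x₁ y₀ y₁ (onPath (suc z) 2+z≤ℓ))
           (trans (pathLabel-suc (extreme-≢ d≡0⊎ℓ 2+z≤ℓ))
                  (cong not (trans (sym (sweep-position d x₀ x₁ y₀ y₁ (onPath z z<ℓ))) fx)))) of λ ()
    where
      z<ℓ : z < ℓ
      z<ℓ = <-trans (n<1+n z) 2+z≤ℓ

  double≤ : ∀ (i : Fin (suc m)) → toℕ i + toℕ i ≤ m + m
  double≤ i = +-mono-≤ i≤m i≤m
    where i≤m = s≤s⁻¹ (Fin.toℕ<n i)

  -- Labelled edges only join a left leaf to 2, so x ⊔ 2 is constant on components.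
  unswept-lower-bound : ∀ x₀ x₁ {c} → HasComponents D (tab (sweep 0 x₀ x₁ true true)) c → 3 + m ≤ c
  unswept-lower-bound x₀ x₁ hc = ≤-components-of-tab f hc (_⊔ 2) edge-invariant w w<N w-labelled w-injective
    where
      f : ℕ → Bool
      f = sweep 0 x₀ x₁ true true
      inner : Fin (suc m) → ℕ
      inner i = 2 + (toℕ i + toℕ i)
      inner<2+ℓ : ∀ i → inner i < 2 + ℓ
      inner<2+ℓ i = s≤s (s≤s (s≤s (m≤n⇒m≤1+n (double≤ i))))
      w : Fin (3 + m) → ℕ
      w = (2 + ℓ) ∷ᶠ (3 + ℓ) ∷ᶠ inner
      w<N : ∀ i → w i < N
      w<N Fin.zero = s≤s (n≤1+n _)
      w<N (Fin.suc Fin.zero) = ≤-refl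
      w<N (Fin.suc (Fin.suc i)) = <-trans (inner<2+ℓ i) (<-trans (n<1+n _) (n<1+n _))
      w-labelled : ∀ i → f (w i) ≡ true
      w-labelled Fin.zero = sweep-position 0 x₀ x₁ true true right₀
      w-labelled (Fin.suc Fin.zero) = sweep-position 0 x₀ x₁ true true right₁
      w-labelled (Fin.suc (Fin.suc i)) =
        trans (sweep-unflipped 0 x₀ x₁ true true (s≤s (m≤n⇒m≤1+n (double≤ i))) z≤n) (even-double (toℕ i))
      last-unlabelled : f (suc ℓ) ≡ false
      last-unlabelled = trans (sweep-unflipped 0 x₀ x₁ true true {suc (m + m)} ≤-refl z≤n)
                              (trans (even-suc (m + m)) (cong not (even-double m)))
      edge-invariant : ∀ {x y} → Edge x y → f x ≡ true → f y ≡ true → x ⊔ 2 ≡ y ⊔ 2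
      edge-invariant (left-leaf {zero} _) _ _ = refl
      edge-invariant (left-leaf {suc zero} _) _ _ = refl
      edge-invariant (left-leaf {suc (suc _)} (s≤s ()))
      edge-invariant (along-path 2≤x x≤ℓ) fx fy =
        ⊥-elim (no-labelled-path-edge 0 x₀ x₁ true true (inj₁ refl) 2≤x x≤ℓ fx fy)
      edge-invariant right-leaf₀ fx _ = case trans (sym fx) last-unlabelled of λ ()
      edge-invariant right-leaf₁ fx _ = case trans (sym fx) last-unlabelled of λ ()
      w-injective : Injective _≡_ _≡_ ((_⊔ 2) ∘′ w)
      w-injective {i} {j} eq =
        cons-injective (cons-injective inner-injective (λ i → <⇒≢ (<-trans (inner<2+ℓ i) (n<1+n _))))
          (λ where Fin.zero → <⇒≢ (n<1+n _) ∘′ sym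
                   (Fin.suc i) → <⇒≢ (inner<2+ℓ i))
          (trans (sym (m≥n⇒m⊔n≡m (w≥2 i))) (trans eq (m≥n⇒m⊔n≡m (w≥2 j))))
        where
          inner-injective : Injective _≡_ _≡_ inner
          inner-injective eq = Fin.toℕ-injective (double-injective (suc-injective (suc-injective eq)))
          w≥2 : ∀ i → 2 ≤ w i
          w≥2 Fin.zero = s≤s (s≤s z≤n)
          w≥2 (Fin.suc Fin.zero) = s≤s (s≤s z≤n)
          w≥2 (Fin.suc (Fin.suc i)) = s≤s (s≤s z≤n)

  -- Labelled edges only join a right leaf to ℓ + 1, so x ⊓ (ℓ + 1) is constant on components.
  swept-lower-bound : ∀ y₀ y₁ {c} → HasComponents D (tab (sweep ℓ true true y₀ y₁)) c → 3 + m ≤ c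
  swept-lower-bound y₀ y₁ hc = ≤-components-of-tab f hc (_⊓ suc ℓ) edge-invariant w w<N w-labelled w-injective
    where
      f : ℕ → Bool
      f = sweep ℓ true true y₀ y₁
      inner : Fin (suc m) → ℕ
      inner i = 3 + (toℕ i + toℕ i)
      inner≤1+ℓ : ∀ i → inner i ≤ suc ℓ
      inner≤1+ℓ i = s≤s (s≤s (s≤s (double≤ i)))
      w : Fin (3 + m) → ℕ
      w = 0 ∷ᶠ 1 ∷ᶠ inner
      w≤1+ℓ : ∀ i → w i ≤ suc ℓ
      w≤1+ℓ Fin.zero = z≤n
      w≤1+ℓ (Fin.suc Fin.zero) = s≤s z≤n
      w≤1+ℓ (Fin.suc (Fin.suc i)) = inner≤1+ℓ i
      w<N : ∀ i → w i < N
      w<N i = s≤s (≤-trans (w≤1+ℓ i) (≤-trans (n≤1+n _) (n≤1+n _)))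
      w-labelled : ∀ i → f (w i) ≡ true
      w-labelled Fin.zero = refl
      w-labelled (Fin.suc Fin.zero) = refl
      w-labelled (Fin.suc (Fin.suc i)) =
        trans (sweep-flipped ℓ true true y₀ y₁ 1+2i<ℓ 1+2i<ℓ)
              (trans (cong not (even-suc (toℕ i + toℕ i))) (trans (not-involutive _) (even-double (toℕ i))))
        where 1+2i<ℓ = s≤s (s≤s (double≤ i))
      edge-invariant : ∀ {x y} → Edge x y → f x ≡ true → f y ≡ true → x ⊓ suc ℓ ≡ y ⊓ suc ℓ
      edge-invariant (left-leaf _) _ ()
      edge-invariant (along-path 2≤x x≤ℓ) fx fy =
        ⊥-elim (no-labelled-path-edge ℓ true true y₀ y₁ (inj₂ refl) 2≤x x≤ℓ fx fy)
      edge-invariant right-leaf₀ _ _ = trans (⊓-idem (suc ℓ)) (sym (m≥n⇒m⊓n≡n (n≤1+n _)))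
      edge-invariant right-leaf₁ _ _ = trans (⊓-idem (suc ℓ)) (sym (m≥n⇒m⊓n≡n (≤-trans (n≤1+n _) (n≤1+n _))))
      w-injective : Injective _≡_ _≡_ ((_⊓ suc ℓ) ∘′ w)
      w-injective {i} {j} eq =
        cons-injective (cons-injective inner-injective (λ _ ())) (λ where Fin.zero (); (Fin.suc _) ())
          (trans (sym (m≤n⇒m⊓n≡m (w≤1+ℓ i))) (trans eq (m≤n⇒m⊓n≡m (w≤1+ℓ j))))
        where
          inner-injective : Injective _≡_ _≡_ inner
          inner-injective eq =
            Fin.toℕ-injective (double-injective (suc-injective (suc-injective (suc-injective eq))))

  Extremal : Labeling N → Set
  Extremal a = HasComponents D a (suc (suc m)) × HasComponentsOn D Path a (suc m)

  unswept-extremal-≈-canonical : ∀ x₀ x₁ y₀ y₁ → Extremal (tab (sweep 0 x₀ x₁ y₀ y₁)) →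
                                 tab (sweep 0 x₀ x₁ y₀ y₁) ≈ canonical
  unswept-extremal-≈-canonical x₀ x₁ true false _ = unswept-≈-canonical x₀ x₁ true false refl
  unswept-extremal-≈-canonical x₀ x₁ false true _ = unswept-≈-canonical x₀ x₁ false true refl
  unswept-extremal-≈-canonical x₀ x₁ true true (hw , _) = ⊥-elim (1+n≰n (unswept-lower-bound x₀ x₁ hw))
  unswept-extremal-≈-canonical x₀ x₁ false false (hw , hp) =
    ⊥-elim (1+n≰n (components-≤-path-components (tab f) hw hp (λ _ → f₂) (λ _ → f₂)
                     (λ t → case trans (sym t) f₂₊ℓ of λ ()) (λ t → case trans (sym t) f₃₊ℓ of λ ())))
    where
      f : ℕ → Bool
      f = sweep 0 x₀ x₁ false false
      f₂ : label (tab f) 2 ≡ true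
      f₂ = label-tabulate {N} f {2} (s≤s (s≤s (s≤s z≤n)))
      f₂₊ℓ : label (tab f) (2 + ℓ) ≡ false
      f₂₊ℓ = trans (label-tabulate {N} f {2 + ℓ} (s≤s (n≤1+n _))) (sweep-position 0 x₀ x₁ false false right₀)
      f₃₊ℓ : label (tab f) (3 + ℓ) ≡ false
      f₃₊ℓ = trans (label-tabulate {N} f {3 + ℓ} ≤-refl) (sweep-position 0 x₀ x₁ false false right₁)

  swept-extremal-≈-canonical : ∀ x₀ x₁ y₀ y₁ → Extremal (tab (sweep ℓ x₀ x₁ y₀ y₁)) →
                               tab (sweep ℓ x₀ x₁ y₀ y₁) ≈ canonical
  swept-extremal-≈-canonical true false y₀ y₁ _ = fully-swept-≈-canonical true false y₀ y₁ refl
  swept-extremal-≈-canonical false true y₀ y₁ _ = fully-swept-≈-canonical false true y₀ y₁ refl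
  swept-extremal-≈-canonical true true y₀ y₁ (hw , _) = ⊥-elim (1+n≰n (swept-lower-bound y₀ y₁ hw))
  swept-extremal-≈-canonical false false y₀ y₁ (hw , hp) =
    ⊥-elim (1+n≰n (components-≤-path-components (tab f) hw hp (λ ()) (λ ()) (λ _ → f₁₊ℓ) (λ _ → f₁₊ℓ)))
    where
      f : ℕ → Bool
      f = sweep ℓ false false y₀ y₁
      f₁₊ℓ : label (tab f) (suc ℓ) ≡ true
      f₁₊ℓ = trans (label-tabulate {N} f {suc ℓ} (s≤s (s≤s (≤-trans (n≤1+n _) (n≤1+n _)))))
                   (last-path-vertex false false y₀ y₁)

  extremal-≈-canonical : ∀ a → Extremal a → a ≈ canonical
  extremal-≈-canonical a (hw , hp) with label a 2 in a₂ | label a (suc ℓ) in a₃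
  ... | true | true =
    ⊥-elim (1+n≰n (components-≤-path-components a hw hp (λ _ → a₂) (λ _ → a₂) (λ _ → a₃) (λ _ → a₃)))
  ... | false | false = ⊥-elim (path-ends-not-both-unlabelled a hp a₂ a₃)
  ... | true | false =
    subst (_≈ canonical) (sym a≡) (unswept-extremal-≈-canonical _ _ _ _ (subst Extremal a≡ (hw , hp)))
    where a≡ = unswept-form a hp a₃
  ... | false | true =
    subst (_≈ canonical) (sym a≡) (swept-extremal-≈-canonical _ _ _ _ (subst Extremal a≡ (hw , hp)))
    where a≡ = swept-form a hp a₂

  labelled-vertex : ∀ a (P : ℕ → Set) {x} → x < N → P x → label a x ≡ true →
                    ∃[ v ] (P (toℕ v) × lookup a v ≡ true)
  labelled-vertex a P x<N px ax = fromℕ< x<N , subst P (sym v≡x) px ,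
    trans (lookup≡label a (fromℕ< x<N)) (trans (cong (label a) v≡x) ax)
    where v≡x = Fin.toℕ-fromℕ< x<N

-- The statement with 2k + 1 and 2k abstracted as n and p, to be rewritten from k = m + 2.
Lemma2p44 : (k n p : ℕ) → Set
Lemma2p44 k n p =
  (∀ a → ¬ Fixed (Dtilde n) a → HasComponents (Dtilde n) a k →
    ∃[ v ] ((toℕ v ≡ 0 ⊎ toℕ v ≡ 1 ⊎ toℕ v ≡ p ⊎ toℕ v ≡ n) × lookup a v ≡ true))
  × (∀ a b →
    ¬ Fixed (Dtilde n) a → HasComponents (Dtilde n) a k →
    HasComponentsOn (Dtilde n) (pathD n) a (k ∸ 1) →
    ¬ Fixed (Dtilde n) b → HasComponents (Dtilde n) b k →
    HasComponentsOn (Dtilde n) (pathD n) b (k ∸ 1) →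
    Equivalent (Dtilde n) a b)

lemma2p44-suc-suc : ∀ m → Lemma2p44 (suc (suc m)) (AffineD.n m) (2 + AffineD.ℓ m)
lemma2p44-suc-suc m =
  leaf-labelled , λ a b _ hwa hpa _ hwb hpb →
    extremal-≈-canonical a (hwa , hpa) ◅◅ ≈-sym (extremal-≈-canonical b (hwb , hpb))
  where
    open AffineD m
    Leaf : ℕ → Set
    Leaf x = x ≡ 0 ⊎ x ≡ 1 ⊎ x ≡ 2 + ℓ ⊎ x ≡ n
    leaf-labelled : ∀ a → ¬ Fixed D a → HasComponents D a (suc (suc m)) →
                    ∃[ v ] (Leaf (toℕ v) × lookup a v ≡ true)
    leaf-labelled a _ hw with some-leaf-labelled a hw
    ... | inj₁ a₀ = labelled-vertex a Leaf (s≤s z≤n) (inj₁ refl) a₀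
    ... | inj₂ (inj₁ a₁) = labelled-vertex a Leaf (s≤s (s≤s z≤n)) (inj₂ (inj₁ refl)) a₁
    ... | inj₂ (inj₂ (inj₁ a₂)) = labelled-vertex a Leaf (s≤s (n≤1+n _)) (inj₂ (inj₂ (inj₁ refl))) a₂
    ... | inj₂ (inj₂ (inj₂ a₃)) = labelled-vertex a Leaf ≤-refl (inj₂ (inj₂ (inj₂ refl))) a₃

lemma2p44 : (k : ℕ) → 5 ≤ 2 * k + 1 →
    (∀ a → ¬ Fixed (Dtilde (2 * k + 1)) a → HasComponents (Dtilde (2 * k + 1)) a k →
      ∃[ v ] ((toℕ v ≡ 0 ⊎ toℕ v ≡ 1 ⊎ toℕ v ≡ 2 * k ⊎ toℕ v ≡ 2 * k + 1) × lookup a v ≡ true))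
    × (∀ a b →
      ¬ Fixed (Dtilde (2 * k + 1)) a → HasComponents (Dtilde (2 * k + 1)) a k →
      HasComponentsOn (Dtilde (2 * k + 1)) (pathD (2 * k + 1)) a (k ∸ 1) →
      ¬ Fixed (Dtilde (2 * k + 1)) b → HasComponents (Dtilde (2 * k + 1)) b k →
      HasComponentsOn (Dtilde (2 * k + 1)) (pathD (2 * k + 1)) b (k ∸ 1) →
      Equivalent (Dtilde (2 * k + 1)) a b)
lemma2p44 zero (s≤s ())
lemma2p44 (suc zero) (s≤s (s≤s (s≤s ())))
lemma2p44 (suc (suc m)) _ = subst₂ (Lemma2p44 (suc (suc m))) (sym n≡) (sym p≡) (lemma2p44-suc-suc m)
  where
    p≡ : 2 * suc (suc m) ≡ 4 + (m + m)
    p≡ = cong (suc ∘′ suc)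
      (trans (cong (m +_) (+-identityʳ (suc (suc m)))) (trans (+-suc m (suc m)) (cong suc (+-suc m m))))
    n≡ : 2 * suc (suc m) + 1 ≡ 5 + (m + m)
    n≡ = trans (+-comm _ 1) (cong suc p≡)
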